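{- Let $G$ be a permutation group on a finite set which contains odd permutations. Then the set of negative integer roots of $F_G$ is $\{ -1,-2,\dots,-a\}$ for some integer $a\ge1$.
   Context: $F_G(x)=\sum_{g\in G}x^{c(g)}$, where $c(g)$ is the number of cycles of $g$ (including fixed points). -}

module Defs where

open import Data.Nat using (ℕ; zero; suc; _≤_; _<_; _≤?_; _<?_; _%_)
open import Data.Fin using (Fin; toℕ)
open import Data.Fin.Permutation using (Permutation′; _⟨$⟩ʳ_; _∘ₚ_; flip; id)
open import Data.List using (List; length; filter; map; upTo; allFin; cartesianProduct)
open import Data.List.Relation.Unary.All using (All; all?)
open import Data.List.Relation.Unary.Any using (Any)
open import Data.List.Relation.Unary.AllPairs using (AllPairs)
open import Data.Integer using (ℤ; _^_)
open import Data.Integer.Base using () renaming (_+_ to _+ℤ_)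
open import Data.Product using (_×_; _,_; proj₁; proj₂)
open import Relation.Nullary using (¬_)
open import Relation.Nullary.Decidable using (_×-dec_)
open import Relation.Binary.PropositionalEquality using (_≡_)

_≈ₚ_ : ∀ {n} → Permutation′ n → Permutation′ n → Set
_≈ₚ_ {n} g h = (i : Fin n) → g ⟨$⟩ʳ i ≡ h ⟨$⟩ʳ i

iter : ∀ {n} → Permutation′ n → ℕ → Fin n → Fin n
iter g zero    i = i
iter g (suc k) i = g ⟨$⟩ʳ iter g k i

-- i is the least element (w.r.t. toℕ) of its cycle {g^k i : k < n}
-- (every orbit of <g> on Fin n is of this form, since cycles have length ≤ n)
IsCycleMin : ∀ {n} → Permutation′ n → Fin n → Set
IsCycleMin {n} g i = All (λ k → toℕ i ≤ toℕ (iter g k i)) (upTo n)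

-- c(g): number of cycles of g (including fixed points) = number of orbits,
-- counted by their least representatives
cycles : ∀ {n} → Permutation′ n → ℕ
cycles {n} g =
  length (filter (λ i → all? (λ k → toℕ i ≤? toℕ (iter g k i)) (upTo n)) (allFin n))

inversions : ∀ {n} → Permutation′ n → ℕ
inversions {n} g =
  length (filter (λ p → (toℕ (proj₁ p) <? toℕ (proj₂ p))
                        ×-dec (toℕ (g ⟨$⟩ʳ proj₂ p) <? toℕ (g ⟨$⟩ʳ proj₁ p)))
                 (cartesianProduct (allFin n) (allFin n)))

IsOdd : ∀ {n} → Permutation′ n → Set
IsOdd g = inversions g % 2 ≡ 1

-- a permutation group on Fin n, given by the duplicate-free list of its elements
_∈ₚ_ : ∀ {n} → Permutation′ n → List (Permutation′ n) → Set
g ∈ₚ G = Any (λ h → g ≈ₚ h) G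

record IsPermGroup {n : ℕ} (G : List (Permutation′ n)) : Set where
  field
    distinct : AllPairs (λ g h → ¬ (g ≈ₚ h)) G
    hasId    : id ∈ₚ G
    closed∘  : ∀ {g h} → g ∈ₚ G → h ∈ₚ G → (g ∘ₚ h) ∈ₚ G
    closedInv : ∀ {g} → g ∈ₚ G → flip g ∈ₚ G

sumℤ : List ℤ → ℤ
sumℤ = Data.List.foldr _+ℤ_ (Data.Integer.+ 0)

F : ∀ {n} → List (Permutation′ n) → ℤ → ℤ
F G x = sumℤ (map (λ g → x ^ cycles g) G)

-- Write (-k)^c(g) = (-1)^c(g) k^c(g). Here k^c(g) is the number of colourings f : [n] → [k]
-- fixed by g, and (-1)^c(g) = (-1)^n sgn g, because the number of inversions plus the number of cycles
-- of a permutation of [n] has the parity of n. Exchanging the sums gives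
--   (-1)^n F_G(-k) = Σ_f Σ_{g ∈ G, f ∘ g = f} sgn g,
-- and the inner sum vanishes when the stabiliser of f contains an odd element h (right translation by h
-- changes every sign), while otherwise it is the positive size of the stabiliser. So F_G(-k) = 0 iff every
-- k-colouring is fixed by an odd element of G. This property descends from k + 1 to k, holds for k = 1
-- because G contains an odd permutation, and fails for k = n, where a colouring by distinct colours is
-- fixed only by the identity.

module Submission where

open import Defs
open import Data.Nat as ℕ using (ℕ; zero; suc; _+_; _*_; _^_; _∸_; _≤_; _<_; _≤′_; ≤′-refl; ≤′-step; z≤n; s≤s; _%_)
import Data.Nat.Properties as ℕP
import Data.Nat.DivMod as ℕD
open import Data.Nat.Base using (parity)
open import Data.Nat.ListAction using () renaming (sum to sumₗ)
open import Data.Parity.Base as ℙ using (Parity; 0ℙ; 1ℙ)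
import Data.Parity.Properties as ℙP
open import Data.Integer using (ℤ; +_; -_; -[1+_]) renaming (_+_ to _+ℤ_; _*_ to _*ℤ_; _^_ to _^ℤ_)
import Data.Integer.Properties as ZP
open import Data.Fin using (Fin; zero; suc; toℕ; fromℕ; inject₁; lower₁)
import Data.Fin.Properties as FinP
open import Data.Fin.Relation.Unary.Top using (view; ‵fromℕ; ‵inject₁)
open import Data.Fin.Permutation using (Permutation′; _⟨$⟩ʳ_; _⟨$⟩ˡ_; _∘ₚ_; flip; id; transpose; permutation; inverseˡ; inverseʳ)
import Data.Fin.Permutation.Components as PC
open import Data.List using (List; []; _∷_; _++_; allFin; upTo; length; filter; map; tabulate; cartesianProduct)
import Data.List.Properties as ListP
open import Data.List.Relation.Unary.All as All using (All; all?; []; _∷_)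
import Data.List.Relation.Unary.All.Properties as AllP
open import Data.List.Relation.Unary.Any as Any using (Any; here; there)
open import Data.List.Relation.Unary.AllPairs using (AllPairs; []; _∷_)
open import Data.Product using (∃; _×_; _,_; proj₂)
open import Data.Sum using (_⊎_; inj₁; inj₂)
open import Data.Bool using (true; false)
open import Relation.Nullary using (¬_; Dec; yes; no; does; contradiction)
open import Relation.Nullary.Decidable using (_×-dec_)
open import Relation.Binary.Definitions using (tri<; tri≈; tri>)
open import Relation.Binary.Core using (_Preserves_⟶_)
open import Relation.Binary.PropositionalEquality
open import Function using (_∘_; _⇔_; mk⇔; Equivalence)
open import Algebra.Bundles using (Semiring)
import Algebra.Properties.Semiring.Sum as SemiringSum
open import Algebra.Properties.Semiring.Sum ℕP.+-*-semiring
open import Algebra.Properties.CommutativeSemigroup ZP.+-commutativeSemigroup using () renaming (interchange to +-interchange)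
open import Algebra.Properties.CommutativeSemigroup ZP.*-commutativeSemigroup using (x∙yz≈y∙xz)

χ : ∀ {p} {P : Set p} → Dec P → ℕ
χ (yes _) = 1
χ (no _)  = 0

module _ {p q} {P : Set p} {Q : Set q} where

  χ-cong : (P → Q) → (Q → P) → (P? : Dec P) (Q? : Dec Q) → χ P? ≡ χ Q?
  χ-cong _ _ (yes _) (yes _) = refl
  χ-cong f _ (yes p) (no ¬q) = contradiction (f p) ¬q
  χ-cong _ g (no ¬p) (yes q) = contradiction (g q) ¬p
  χ-cong _ _ (no _)  (no _)  = refl

  χ-× : (P? : Dec P) (Q? : Dec Q) → χ (P? ×-dec Q?) ≡ χ P? * χ Q?
  χ-× (yes _) (yes _) = refl
  χ-× (yes _) (no _)  = refl
  χ-× (no _)  (yes _) = refl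
  χ-× (no _)  (no _)  = refl

module _ {p} {P : Set p} where

  χ-yes : P → (P? : Dec P) → χ P? ≡ 1
  χ-yes _ (yes _) = refl
  χ-yes p (no ¬p) = contradiction p ¬p

  χ-no : ¬ P → (P? : Dec P) → χ P? ≡ 0
  χ-no ¬p (yes p) = contradiction p ¬p
  χ-no _  (no _)  = refl

χ< : ℕ → ℕ → ℕ
χ< a b = χ (a ℕ.<? b)

χ<-irrefl : ∀ a → χ< a a ≡ 0
χ<-irrefl a = χ-no (ℕP.<-irrefl refl) _

χ<-cases : ∀ {a b} → a ≢ b → (χ< a b ≡ 1 × χ< b a ≡ 0) ⊎ (χ< a b ≡ 0 × χ< b a ≡ 1)
χ<-cases {a} {b} a≢b with ℕP.<-cmp a b
... | tri< a<b _ _ = inj₁ (χ-yes a<b _ , χ-no (ℕP.<⇒≯ a<b) _)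
... | tri≈ _ a≡b _ = contradiction a≡b a≢b
... | tri> _ _ b<a = inj₂ (χ-no (ℕP.<⇒≯ b<a) _ , χ-yes b<a _)

sum-zero : ∀ {n} {f : Fin n → ℕ} → (∀ i → f i ≡ 0) → ∑[ i < n ] f i ≡ 0
sum-zero {n} e = trans (sum-cong-≗ e) (sum-replicate-zero n)

sum≡0⇒ : ∀ {k} (φ : Fin k → ℕ) → ∑[ c < k ] φ c ≡ 0 → ∀ c → φ c ≡ 0
sum≡0⇒ φ e zero    = ℕP.m+n≡0⇒m≡0 (φ zero) e
sum≡0⇒ φ e (suc c) = sum≡0⇒ (φ ∘ suc) (ℕP.m+n≡0⇒n≡0 (φ zero) e) c

sum-1 : ∀ k → ∑[ c < k ] 1 ≡ k
sum-1 zero    = refl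
sum-1 (suc k) = cong suc (sum-1 k)

sum-δ : ∀ {n a} → a < n → (f : ℕ → ℕ) → ∑[ i < n ] (χ (toℕ i ℕP.≟ a) * f (toℕ i)) ≡ f a
sum-δ {suc n} {zero}  _         f = trans (cong (_+_ (f 0 + 0)) (sum-zero {n} λ _ → refl)) (trans (ℕP.+-identityʳ _) (ℕP.+-identityʳ _))
sum-δ {suc n} {suc a} (s≤s a<n) f = trans
  (sum-cong-≗ {n} λ i → cong (_* f (suc (toℕ i))) (χ-cong ℕP.suc-injective (cong suc) (suc (toℕ i) ℕP.≟ suc a) (toℕ i ℕP.≟ a)))
  (sum-δ a<n (f ∘ suc))

sum-χ≟ : ∀ {k} (v : Fin k) → ∑[ c < k ] χ (v FinP.≟ c) ≡ 1
sum-χ≟ {suc k} zero    = cong suc (sum-zero {k} (λ _ → refl))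
sum-χ≟ {suc k} (suc v) = trans (sum-cong-≗ {k} λ c → χ-cong FinP.suc-injective (cong suc) (suc v FinP.≟ suc c) (v FinP.≟ c)) (sum-χ≟ v)

∑² : ∀ {n} → (Fin n → Fin n → ℕ) → ℕ
∑² {n} f = ∑[ i < n ] ∑[ j < n ] f i j

∑²-distrib-+ : ∀ {n} (f f′ : Fin n → Fin n → ℕ) → ∑² (λ i j → f i j + f′ i j) ≡ ∑² f + ∑² f′
∑²-distrib-+ f f′ = trans (sum-cong-≗ λ i → ∑-distrib-+ (f i) (f′ i)) (∑-distrib-+ (sum ∘ f) (sum ∘ f′))

*-distribˡ-∑² : ∀ {n} c (f : Fin n → Fin n → ℕ) → c * ∑² f ≡ ∑² (λ i j → c * f i j)
*-distribˡ-∑² c f = trans (*-distribˡ-sum c (sum ∘ f)) (sum-cong-≗ λ i → *-distribˡ-sum c (f i))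

∑²-symmetric : ∀ {n} (ψ : Fin n → Fin n → ℕ) → (∀ i j → ψ i j ≡ ψ j i) → (∀ i → ψ i i ≡ 0) →
  ∑² ψ ≡ 2 * ∑² (λ i j → χ< (toℕ i) (toℕ j) * ψ i j)
∑²-symmetric ψ sym-ψ diag-ψ = begin
  ∑² ψ                                     ≡⟨ sum-cong-≗ (λ i → sum-cong-≗ (split i)) ⟩
  ∑² (λ i j → above i j + above j i)        ≡⟨ ∑²-distrib-+ above (λ i j → above j i) ⟩
  A + ∑² (λ i j → above j i)                ≡⟨ cong (_+_ A) (∑-comm (λ i j → above j i)) ⟩
  A + A                                     ≡⟨ cong (_+_ A) (ℕP.+-identityʳ A) ⟨
  2 * A                                     ∎
  where
  open ≡-Reasoning
  above = λ i j → χ< (toℕ i) (toℕ j) * ψ i j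
  A = ∑² above
  split : ∀ i j → ψ i j ≡ above i j + above j i
  split i j with toℕ i ℕP.≟ toℕ j
  ... | yes e rewrite FinP.toℕ-injective e | diag-ψ j | χ<-irrefl (toℕ j) = refl
  ... | no ne with χ<-cases ne
  ...   | inj₁ (p , q) rewrite p | q = sym (trans (ℕP.+-identityʳ _) (ℕP.+-identityʳ _))
  ...   | inj₂ (p , q) rewrite p | q = trans (sym-ψ i j) (sym (ℕP.+-identityʳ _))

∑²-init-last : ∀ {n} (f : Fin (suc n) → Fin (suc n) → ℕ) →
  ∑² f ≡ ∑² (λ i j → f (inject₁ i) (inject₁ j)) + ∑[ i < n ] f (inject₁ i) (fromℕ n) + ∑[ j < suc n ] f (fromℕ n) j
∑²-init-last {n} f = trans (sum-init-last (λ i → ∑[ j < suc n ] f i j))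
  (cong (_+ ∑[ j < suc n ] f (fromℕ n) j)
    (trans (sum-cong-≗ λ i → sum-init-last (f (inject₁ i)))
      (∑-distrib-+ (λ i → ∑[ j < n ] f (inject₁ i) (inject₁ j)) (λ i → f (inject₁ i) (fromℕ n)))))

module ℤΣ = SemiringSum ZP.+-*-semiring

sum-pos : ∀ {k} (φ : Fin k → ℕ) → ℤΣ.sum (λ c → + φ c) ≡ + ∑[ c < k ] φ c
sum-pos {zero}  φ = refl
sum-pos {suc k} φ = trans (cong (+ φ zero +ℤ_) (sum-pos (φ ∘ suc))) (sym (ZP.pos-+ (φ zero) _))

length-filter-tabulate : ∀ {a p} {A : Set a} {P : A → Set p} (P? : ∀ x → Dec (P x)) {n} (f : Fin n → A) →
  length (filter P? (tabulate f)) ≡ ∑[ i < n ] χ (P? (f i))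
length-filter-tabulate P? {zero}  f = refl
length-filter-tabulate P? {suc n} f with P? (f zero)
... | yes _ = cong suc (length-filter-tabulate P? (f ∘ suc))
... | no _  = length-filter-tabulate P? (f ∘ suc)

length-filter-map : ∀ {a b p} {A : Set a} {B : Set b} {P : B → Set p} (P? : ∀ x → Dec (P x)) (h : A → B) (xs : List A) →
  length (filter P? (map h xs)) ≡ length (filter (P? ∘ h) xs)
length-filter-map P? h []       = refl
length-filter-map P? h (x ∷ xs) with does (P? (h x))
... | true  = cong suc (length-filter-map P? h xs)
... | false = length-filter-map P? h xs

length-filter-cartesianProduct : ∀ {a b p} {A : Set a} {B : Set b} {P : A × B → Set p} (P? : ∀ x → Dec (P x))
  {n} (f : Fin n → A) (ys : List B) →
  length (filter P? (cartesianProduct (tabulate f) ys)) ≡ ∑[ i < n ] length (filter (λ y → P? (f i , y)) ys)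
length-filter-cartesianProduct P? {zero}  f ys = refl
length-filter-cartesianProduct P? {suc n} f ys = begin
  length (filter P? (map (f zero ,_) ys ++ rest))
    ≡⟨ cong length (ListP.filter-++ P? (map (f zero ,_) ys) rest) ⟩
  length (filter P? (map (f zero ,_) ys) ++ filter P? rest)
    ≡⟨ ListP.length-++ (filter P? (map (f zero ,_) ys)) ⟩
  length (filter P? (map (f zero ,_) ys)) + length (filter P? rest)
    ≡⟨ cong₂ _+_ (length-filter-map P? (f zero ,_) ys) (length-filter-cartesianProduct P? (f ∘ suc) ys) ⟩
  _ ∎
  where
  open ≡-Reasoning
  rest = cartesianProduct (tabulate (f ∘ suc)) ys

%2≡1⇒parity≡1ℙ : ∀ m → m % 2 ≡ 1 → parity m ≡ 1ℙ
%2≡1⇒parity≡1ℙ 1             _ = refl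
%2≡1⇒parity≡1ℙ (suc (suc m)) e = %2≡1⇒parity≡1ℙ m (trans (sym (ℕD.[m+n]%n≡m%n m 2)) (trans (cong (_% 2) (ℕP.+-comm m 2)) e))

sign : Parity → ℤ
sign 0ℙ = + 1
sign 1ℙ = - + 1

sign-⁻¹ : ∀ p → sign (p ℙ.⁻¹) ≡ - sign p
sign-⁻¹ 0ℙ = refl
sign-⁻¹ 1ℙ = refl

sign*x≡0⇒x≡0 : ∀ p {x} → sign p *ℤ x ≡ + 0 → x ≡ + 0
sign*x≡0⇒x≡0 0ℙ {x} e = trans (sym (ZP.*-identityˡ x)) e
sign*x≡0⇒x≡0 1ℙ {x} e = trans (sym (ZP.neg-involutive x)) (cong -_ (trans (sym (ZP.-1*i≡-i x)) e))

neg-^ : ∀ k c → (- (+ k)) ^ℤ c ≡ sign (parity c) *ℤ + (k ^ c)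
neg-^ k zero    = refl
neg-^ k (suc c) = begin
  - + k *ℤ (- + k) ^ℤ c                       ≡⟨ cong (- + k *ℤ_) (neg-^ k c) ⟩
  - + k *ℤ (sign (parity c) *ℤ + (k ^ c))     ≡⟨ x∙yz≈y∙xz (- + k) (sign (parity c)) (+ (k ^ c)) ⟩
  sign (parity c) *ℤ (- + k *ℤ + (k ^ c))     ≡⟨ cong (sign (parity c) *ℤ_) (ZP.neg-distribˡ-* (+ k) (+ (k ^ c))) ⟨
  sign (parity c) *ℤ - (+ k *ℤ + (k ^ c))     ≡⟨ ZP.neg-distribʳ-* (sign (parity c)) _ ⟨
  - (sign (parity c) *ℤ (+ k *ℤ + (k ^ c)))   ≡⟨ ZP.neg-distribˡ-* (sign (parity c)) _ ⟩
  - sign (parity c) *ℤ (+ k *ℤ + (k ^ c))     ≡⟨ cong₂ _*ℤ_ (sym (sign-⁻¹ (parity c))) (sym (ZP.pos-* k (k ^ c))) ⟩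
  sign (1ℙ ℙ.+ parity c) *ℤ + (k * k ^ c)     ≡⟨ cong (λ p → sign p *ℤ + (k ^ suc c)) (ℙP.+-homo-+ 1 c) ⟨
  sign (parity (suc c)) *ℤ + (k ^ suc c)      ∎
  where open ≡-Reasoning

perm-injective : ∀ {n} (g : Permutation′ n) {x y} → g ⟨$⟩ʳ x ≡ g ⟨$⟩ʳ y → x ≡ y
perm-injective g {x} {y} e = trans (sym (inverseˡ g)) (trans (cong (g ⟨$⟩ˡ_) e) (inverseˡ g))

_≈ₚ?_ : ∀ {n} (g h : Permutation′ n) → Dec (g ≈ₚ h)
g ≈ₚ? h = FinP.all? (λ i → g ⟨$⟩ʳ i FinP.≟ h ⟨$⟩ʳ i)

inversion : ∀ {n} → Permutation′ n → Fin n → Fin n → ℕ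
inversion g i j = χ< (toℕ i) (toℕ j) * χ< (toℕ (g ⟨$⟩ʳ j)) (toℕ (g ⟨$⟩ʳ i))

inversions-∑ : ∀ {n} (g : Permutation′ n) → inversions g ≡ ∑² (inversion g)
inversions-∑ {n} g = trans (length-filter-cartesianProduct isInversion? (λ i → i) (allFin n))
  (sum-cong-≗ λ i → trans (length-filter-tabulate (λ j → isInversion? (i , j)) (λ j → j))
    (sum-cong-≗ λ j → χ-× (toℕ i ℕ.<? toℕ j) (toℕ (g ⟨$⟩ʳ j) ℕ.<? toℕ (g ⟨$⟩ʳ i))))
  where
  isInversion? : (p : Fin n × Fin n) → Dec _
  isInversion? (i , j) = (toℕ i ℕ.<? toℕ j) ×-dec (toℕ (g ⟨$⟩ʳ j) ℕ.<? toℕ (g ⟨$⟩ʳ i))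

inversions-cong : ∀ {n} {g h : Permutation′ n} → g ≈ₚ h → inversions g ≡ inversions h
inversions-cong {g = g} {h} e = trans (inversions-∑ g) (trans (sum-cong-≗ λ i → sum-cong-≗ λ j →
  cong₂ (λ x y → χ< (toℕ i) (toℕ j) * χ< (toℕ x) (toℕ y)) (e j) (e i)) (sym (inversions-∑ h)))

inversions-id : ∀ n → inversions (id {n}) ≡ 0
inversions-id n = trans (inversions-∑ (id {n})) (sum-zero {n} λ i → sum-zero {n} λ j → no-inversion (toℕ i) (toℕ j))
  where
  no-inversion : ∀ a b → χ< a b * χ< b a ≡ 0
  no-inversion a b with a ℕ.<? b
  ... | no _    = refl
  ... | yes a<b rewrite χ-no (ℕP.<⇒≯ a<b) (b ℕ.<? a) = refl

OddParity : ∀ {n} → Permutation′ n → Set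
OddParity g = parity (inversions g) ≡ 1ℙ

iter-+ : ∀ {n} (g : Permutation′ n) a b i → iter g (a + b) i ≡ iter g a (iter g b i)
iter-+ g zero    b i = refl
iter-+ g (suc a) b i = cong (g ⟨$⟩ʳ_) (iter-+ g a b i)

iter-injective : ∀ {n} (g : Permutation′ n) k {x y} → iter g k x ≡ iter g k y → x ≡ y
iter-injective g zero    e = e
iter-injective g (suc k) e = iter-injective g k (perm-injective g e)

iter-cong : ∀ {n} {g h : Permutation′ n} → g ≈ₚ h → ∀ k i → iter g k i ≡ iter h k i
iter-cong e zero    i = refl
iter-cong {g = g} {h} e (suc k) i = trans (cong (g ⟨$⟩ʳ_) (iter-cong e k i)) (e (iter h k i))

iter-fixed : ∀ {n} (g : Permutation′ n) {i} → g ⟨$⟩ʳ i ≡ i → ∀ k → iter g k i ≡ i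
iter-fixed g e zero    = refl
iter-fixed g e (suc k) = trans (cong (g ⟨$⟩ʳ_) (iter-fixed g e k)) e

iter-period : ∀ {n} (g : Permutation′ n) (i : Fin n) → ∃ λ p → iter g (suc p) i ≡ i × suc p ≤ n
iter-period {n} g i with FinP.pigeonhole (ℕP.n<1+n n) (λ (k : Fin (suc n)) → iter g (toℕ k) i)
... | a , b , a<b , e = p , iter-injective g (toℕ a) returns , ≤-bound
  where
  open ≡-Reasoning
  p = toℕ b ∸ suc (toℕ a)
  p+a≡b : suc p + toℕ a ≡ toℕ b
  p+a≡b = trans (sym (ℕP.+-suc p (toℕ a))) (ℕP.m∸n+n≡m a<b)
  returns : iter g (toℕ a) (iter g (suc p) i) ≡ iter g (toℕ a) i
  returns = begin
    iter g (toℕ a) (iter g (suc p) i) ≡⟨ sym (iter-+ g (toℕ a) (suc p) i) ⟩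
    iter g (toℕ a + suc p) i          ≡⟨ cong (λ m → iter g m i) (trans (ℕP.+-comm (toℕ a) (suc p)) p+a≡b) ⟩
    iter g (toℕ b) i                  ≡⟨ sym e ⟩
    iter g (toℕ a) i                  ∎
  ≤-bound : suc p ≤ n
  ≤-bound = ℕP.≤-trans (ℕP.m≤m+n (suc p) (toℕ a)) (ℕP.≤-trans (ℕP.≤-reflexive p+a≡b) (ℕP.≤-pred (FinP.toℕ<n b)))

iter-multiple : ∀ {n} (g : Permutation′ n) {i} p → iter g p i ≡ i → ∀ q → iter g (q * p) i ≡ i
iter-multiple g p e zero    = refl
iter-multiple g {i} p e (suc q) = trans (iter-+ g p (q * p) i) (trans (cong (iter g p) (iter-multiple g p e q)) e)

iter-below : ∀ {n} (g : Permutation′ n) (i : Fin n) k → ∃ λ r → r < n × iter g k i ≡ iter g r i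
iter-below g i k with iter-period g i
... | p , returns , p<n = k ℕ.% suc p , ℕP.<-≤-trans (ℕD.m%n<n k (suc p)) p<n , (begin
  iter g k i                                        ≡⟨ cong (λ m → iter g m i) (ℕD.m≡m%n+[m/n]*n k (suc p)) ⟩
  iter g (k ℕ.% suc p + k ℕ./ suc p * suc p) i       ≡⟨ iter-+ g (k ℕ.% suc p) _ i ⟩
  iter g (k ℕ.% suc p) (iter g (k ℕ./ suc p * suc p) i) ≡⟨ cong (iter g (k ℕ.% suc p)) (iter-multiple g (suc p) returns (k ℕ./ suc p)) ⟩
  iter g (k ℕ.% suc p) i                             ∎)
  where open ≡-Reasoning

IsOrbitMin : ∀ {n} → Permutation′ n → Fin n → Set
IsOrbitMin g i = ∀ k → toℕ i ≤ toℕ (iter g k i)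

IsCycleMin⇒IsOrbitMin : ∀ {n} (g : Permutation′ n) {i} → IsCycleMin g i → IsOrbitMin g i
IsCycleMin⇒IsOrbitMin {n} g {i} min k with iter-below g i k
... | r , r<n , e = subst (λ y → toℕ i ≤ toℕ y) (sym e) (AllP.applyUpTo⁻ (λ x → x) n min r<n)

IsOrbitMin⇒IsCycleMin : ∀ {n} (g : Permutation′ n) {i} → IsOrbitMin g i → IsCycleMin g i
IsOrbitMin⇒IsCycleMin {n} g min = AllP.applyUpTo⁺₂ (λ x → x) n min

isCycleMin? : ∀ {n} (g : Permutation′ n) i → Dec (IsCycleMin g i)
isCycleMin? {n} g i = all? (λ k → toℕ i ℕ.≤? toℕ (iter g k i)) (upTo n)

cycles-∑ : ∀ {n} (g : Permutation′ n) → cycles g ≡ ∑[ i < n ] χ (isCycleMin? g i)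
cycles-∑ g = length-filter-tabulate (isCycleMin? g) (λ i → i)

χ-isCycleMin?-cong : ∀ {m n} (g : Permutation′ m) (h : Permutation′ n) {i j} →
  (IsOrbitMin g i → IsOrbitMin h j) → (IsOrbitMin h j → IsOrbitMin g i) →
  χ (isCycleMin? g i) ≡ χ (isCycleMin? h j)
χ-isCycleMin?-cong g h to from = χ-cong
  (IsOrbitMin⇒IsCycleMin h ∘ to ∘ IsCycleMin⇒IsOrbitMin g) (IsOrbitMin⇒IsCycleMin g ∘ from ∘ IsCycleMin⇒IsOrbitMin h) _ _

χ-isCycleMin?-fixed : ∀ {n} (g : Permutation′ n) {i} → g ⟨$⟩ʳ i ≡ i → χ (isCycleMin? g i) ≡ 1
χ-isCycleMin?-fixed g e = χ-yes (IsOrbitMin⇒IsCycleMin g λ k → ℕP.≤-reflexive (cong toℕ (sym (iter-fixed g e k)))) _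

cycles-cong : ∀ {n} {g h : Permutation′ n} → g ≈ₚ h → cycles g ≡ cycles h
cycles-cong {g = g} {h} e = trans (cycles-∑ g) (trans (sum-cong-≗ λ i → χ-isCycleMin?-cong g h
  (λ min k → subst (λ y → toℕ i ≤ toℕ y) (iter-cong e k i) (min k))
  (λ min k → subst (λ y → toℕ i ≤ toℕ y) (sym (iter-cong e k i)) (min k))) (sym (cycles-∑ h)))

≢fromℕ⇒toℕ< : ∀ {n} (y : Fin (suc n)) → y ≢ fromℕ n → toℕ y < n
≢fromℕ⇒toℕ< {n} y y≢ with ℕP.m≤n⇒m<n∨m≡n (FinP.toℕ≤pred[n] y)
... | inj₁ lt = lt
... | inj₂ eq = contradiction (FinP.toℕ-injective (trans eq (sym (FinP.toℕ-fromℕ n)))) y≢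

inject₁≢fromℕ : ∀ {n} (x : Fin n) → inject₁ x ≢ fromℕ n
inject₁≢fromℕ x e = FinP.fromℕ≢inject₁ (sym e)

≢fromℕ⇒inject₁ : ∀ {n} (x : Fin (suc n)) → x ≢ fromℕ n → ∃ λ y → x ≡ inject₁ y
≢fromℕ⇒inject₁ x x≢ with view x
... | ‵fromℕ     = contradiction refl x≢
... | ‵inject₁ y = y , refl

χ<-fromℕ : ∀ {n} (x : Fin (suc n)) → χ< (toℕ (fromℕ n)) (toℕ x) ≡ 0
χ<-fromℕ {n} x = χ-no (ℕP.≤⇒≯ (subst (toℕ x ≤_) (sym (FinP.toℕ-fromℕ n)) (FinP.toℕ≤pred[n] x))) _

inversion-fromℕ : ∀ {n} (g : Permutation′ (suc n)) j → inversion g (fromℕ n) j ≡ 0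
inversion-fromℕ g j = cong (_* χ< (toℕ (g ⟨$⟩ʳ j)) (toℕ (g ⟨$⟩ʳ fromℕ _))) (χ<-fromℕ j)

module Restriction {n} (h : Permutation′ (suc n)) (h-last : h ⟨$⟩ʳ fromℕ n ≡ fromℕ n) where

  private
    last = fromℕ n

    h≢last : ∀ x → h ⟨$⟩ʳ inject₁ x ≢ last
    h≢last x e = inject₁≢fromℕ x (perm-injective h (trans e (sym h-last)))

    h⁻¹≢last : ∀ x → h ⟨$⟩ˡ inject₁ x ≢ last
    h⁻¹≢last x e = inject₁≢fromℕ x (trans (sym (inverseʳ h)) (trans (cong (h ⟨$⟩ʳ_) e) h-last))

    to : Fin n → Fin n
    to x = lower₁ (h ⟨$⟩ʳ inject₁ x) (ℕP.<⇒≢ (≢fromℕ⇒toℕ< _ (h≢last x)) ∘ sym)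

    from : Fin n → Fin n
    from x = lower₁ (h ⟨$⟩ˡ inject₁ x) (ℕP.<⇒≢ (≢fromℕ⇒toℕ< _ (h⁻¹≢last x)) ∘ sym)

    inject₁-from : ∀ x → inject₁ (from x) ≡ h ⟨$⟩ˡ inject₁ x
    inject₁-from x = FinP.inject₁-lower₁ _ _

  restriction : Permutation′ n
  restriction = permutation to from
    (λ y → FinP.inject₁-injective (trans (FinP.inject₁-lower₁ _ _) (trans (cong (h ⟨$⟩ʳ_) (inject₁-from y)) (inverseʳ h))))
    (λ y → FinP.inject₁-injective (trans (inject₁-from (to y)) (trans (cong (h ⟨$⟩ˡ_) (FinP.inject₁-lower₁ _ _)) (inverseˡ h))))

  restriction-inject₁ : ∀ x → inject₁ (restriction ⟨$⟩ʳ x) ≡ h ⟨$⟩ʳ inject₁ x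
  restriction-inject₁ x = FinP.inject₁-lower₁ _ _

  toℕ-restriction : ∀ x → toℕ (restriction ⟨$⟩ʳ x) ≡ toℕ (h ⟨$⟩ʳ inject₁ x)
  toℕ-restriction x = trans (sym (FinP.toℕ-inject₁ _)) (cong toℕ (restriction-inject₁ x))

  iter-inject₁ : ∀ k x → iter h k (inject₁ x) ≡ inject₁ (iter restriction k x)
  iter-inject₁ zero    x = refl
  iter-inject₁ (suc k) x = trans (cong (h ⟨$⟩ʳ_) (iter-inject₁ k x)) (sym (restriction-inject₁ (iter restriction k x)))

  χ-isCycleMin?-inject₁ : ∀ i → χ (isCycleMin? h (inject₁ i)) ≡ χ (isCycleMin? restriction i)
  χ-isCycleMin?-inject₁ i = χ-isCycleMin?-cong h restriction
    (λ min k → subst₂ _≤_ (FinP.toℕ-inject₁ i) (trans (cong toℕ (iter-inject₁ k i)) (FinP.toℕ-inject₁ _)) (min k))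
    (λ min k → subst₂ _≤_ (sym (FinP.toℕ-inject₁ i)) (sym (trans (cong toℕ (iter-inject₁ k i)) (FinP.toℕ-inject₁ _))) (min k))

  inversions-restriction : inversions h ≡ inversions restriction
  inversions-restriction = begin
    inversions h        ≡⟨ inversions-∑ h ⟩
    ∑² (inversion h)    ≡⟨ ∑²-init-last (inversion h) ⟩
    ∑² (λ i j → inversion h (inject₁ i) (inject₁ j)) + ∑[ i < n ] inversion h (inject₁ i) last + ∑[ j < suc n ] inversion h last j
      ≡⟨ cong₂ _+_ (cong₂ _+_ (sum-cong-≗ λ i → sum-cong-≗ λ j → inner i j) (sum-zero last-column))
                   (sum-zero (inversion-fromℕ h)) ⟩
    ∑² (inversion restriction) + 0 + 0 ≡⟨ trans (ℕP.+-identityʳ _) (ℕP.+-identityʳ _) ⟩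
    ∑² (inversion restriction) ≡⟨ inversions-∑ restriction ⟨
    inversions restriction ∎
    where
    open ≡-Reasoning
    inner : ∀ i j → inversion h (inject₁ i) (inject₁ j) ≡ inversion restriction i j
    inner i j = cong₂ _*_ (cong₂ χ< (FinP.toℕ-inject₁ i) (FinP.toℕ-inject₁ j))
                          (sym (cong₂ χ< (toℕ-restriction j) (toℕ-restriction i)))
    last-column : ∀ i → inversion h (inject₁ i) last ≡ 0
    last-column i = trans (cong (λ y → χ< (toℕ (inject₁ i)) (toℕ last) * χ< (toℕ y) (toℕ (h ⟨$⟩ʳ inject₁ i))) h-last)
      (trans (cong (χ< (toℕ (inject₁ i)) (toℕ last) *_) (χ<-fromℕ (h ⟨$⟩ʳ inject₁ i))) (ℕP.*-zeroʳ (χ< (toℕ (inject₁ i)) (toℕ last))))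

module _ {n} (i j : Fin n) where

  transpose-matchˡ : PC.transpose i j i ≡ j
  transpose-matchˡ with i FinP.≟ i
  ... | yes _ = refl
  ... | no i≢i = contradiction refl i≢i

  transpose-matchʳ : PC.transpose i j j ≡ i
  transpose-matchʳ with j FinP.≟ i
  ... | yes j≡i = j≡i
  ... | no _ with j FinP.≟ j
  ...   | yes _ = refl
  ...   | no j≢j = contradiction refl j≢j

  transpose-noMatch : ∀ {k} → k ≢ i → k ≢ j → PC.transpose i j k ≡ k
  transpose-noMatch {k} k≢i k≢j with k FinP.≟ i
  ... | yes k≡i = contradiction k≡i k≢i
  ... | no _ with k FinP.≟ j
  ...   | yes k≡j = contradiction k≡j k≢j
  ...   | no _ = refl

  transpose-same : ∀ {a} {A : Set a} (f : Fin n → A) → f i ≡ f j → ∀ k → f (PC.transpose i j k) ≡ f k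
  transpose-same f fi≡fj k = cases (k FinP.≟ i) (k FinP.≟ j)
    where
    cases : Dec (k ≡ i) → Dec (k ≡ j) → f (PC.transpose i j k) ≡ f k
    cases (yes refl) _          = trans (cong f transpose-matchˡ) (sym fi≡fj)
    cases (no _)     (yes refl) = trans (cong f transpose-matchʳ) fi≡fj
    cases (no k≢i)   (no k≢j)   = cong f (transpose-noMatch k≢i k≢j)

  transpose-involutive : ∀ k → PC.transpose i j (PC.transpose i j k) ≡ k
  transpose-involutive k = cases (k FinP.≟ i) (k FinP.≟ j)
    where
    cases : Dec (k ≡ i) → Dec (k ≡ j) → PC.transpose i j (PC.transpose i j k) ≡ k
    cases (yes refl) _          = trans (cong (PC.transpose i j) transpose-matchˡ) transpose-matchʳ
    cases (no _)     (yes refl) = trans (cong (PC.transpose i j) transpose-matchʳ) transpose-matchˡ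
    cases (no k≢i)   (no k≢j)   = trans (cong (PC.transpose i j) (transpose-noMatch k≢i k≢j)) (transpose-noMatch k≢i k≢j)

transpose-diagonal : ∀ {n} (i k : Fin n) → PC.transpose i i k ≡ k
transpose-diagonal i = transpose-same i i (λ x → x) refl

-- With L = fromℕ n the last point, w = g L and τ = (w L), h = g ∘ₚ τ (first g, then τ) fixes L; on the other
-- points h is g with L cut out of its cycle: h z = g (g z) if g z = L, and h z = g z otherwise.
module Decomposition {n} (g : Permutation′ (suc n)) where

  last : Fin (suc n)
  last = fromℕ n

  w : Fin (suc n)
  w = g ⟨$⟩ʳ last

  τ : Permutation′ (suc n)
  τ = transpose w last

  h : Permutation′ (suc n)
  h = g ∘ₚ τ

  h-last : h ⟨$⟩ʳ last ≡ last
  h-last = transpose-matchˡ w last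

  open Restriction h h-last public using (restriction; restriction-inject₁; χ-isCycleMin?-inject₁; inversions-restriction)

  g≈h∘τ : g ≈ₚ (h ∘ₚ τ)
  g≈h∘τ x = sym (transpose-involutive w last (g ⟨$⟩ʳ x))

  w≡last⇒g≈h : w ≡ last → g ≈ₚ h
  w≡last⇒g≈h e x = sym (trans (cong (λ v → PC.transpose v last (g ⟨$⟩ʳ x)) e) (transpose-diagonal last (g ⟨$⟩ʳ x)))

  private
    iter-h-last : ∀ m → iter h m last ≡ last
    iter-h-last = iter-fixed h h-last

    iter-h≢last : ∀ {y} → y ≢ last → ∀ m → iter h m y ≢ last
    iter-h≢last y≢ m e = y≢ (iter-injective h m (trans e (sym (iter-h-last m))))

    h-skip : ∀ {z} → g ⟨$⟩ʳ z ≡ last → h ⟨$⟩ʳ z ≡ g ⟨$⟩ʳ (g ⟨$⟩ʳ z)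
    h-skip e = trans (cong (PC.transpose w last) e) (trans (transpose-matchʳ w last) (cong (g ⟨$⟩ʳ_) (sym e)))

    h-step : ∀ {z} → z ≢ last → g ⟨$⟩ʳ z ≢ last → h ⟨$⟩ʳ z ≡ g ⟨$⟩ʳ z
    h-step z≢ gz≢ = transpose-noMatch w last (z≢ ∘ perm-injective g) gz≢

    h-orbit⊆g-orbit : ∀ {y} → y ≢ last → ∀ m → ∃ λ k → iter h m y ≡ iter g k y
    h-orbit⊆g-orbit y≢ zero = 0 , refl
    h-orbit⊆g-orbit {y} y≢ (suc m) with h-orbit⊆g-orbit y≢ m | g ⟨$⟩ʳ iter h m y FinP.≟ last
    ... | k , e | yes ≡last = suc (suc k) , trans (h-skip ≡last) (cong (λ z → g ⟨$⟩ʳ (g ⟨$⟩ʳ z)) e)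
    ... | k , e | no ≢last  = suc k , trans (h-step (iter-h≢last y≢ m) ≢last) (cong (g ⟨$⟩ʳ_) e)

    g-orbit⊆h-orbit : ∀ {y} → y ≢ last → ∀ k → ∃ λ m →
      iter h m y ≡ iter g k y ⊎ (iter g k y ≡ last × iter h m y ≡ g ⟨$⟩ʳ iter g k y)
    g-orbit⊆h-orbit y≢ zero = 0 , inj₁ refl
    g-orbit⊆h-orbit {y} y≢ (suc k) with g-orbit⊆h-orbit y≢ k
    ... | m , inj₂ (_ , e) = m , inj₁ e
    ... | m , inj₁ e with g ⟨$⟩ʳ iter g k y FinP.≟ last
    ...   | yes ≡last = suc m , inj₂ (≡last , trans (h-skip (trans (cong (g ⟨$⟩ʳ_) e) ≡last)) (cong (λ z → g ⟨$⟩ʳ (g ⟨$⟩ʳ z)) e))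
    ...   | no ≢last  = suc m , inj₁ (trans (h-step (iter-h≢last y≢ m) (≢last ∘ trans (cong (g ⟨$⟩ʳ_) (sym e)))) (cong (g ⟨$⟩ʳ_) e))

    toℕ≤toℕ-last : ∀ (y : Fin (suc n)) → toℕ y ≤ toℕ last
    toℕ≤toℕ-last y = subst (toℕ y ≤_) (sym (FinP.toℕ-fromℕ n)) (FinP.toℕ≤pred[n] y)

    χ-isCycleMin?-g≡h : ∀ {y} → y ≢ last → χ (isCycleMin? g y) ≡ χ (isCycleMin? h y)
    χ-isCycleMin?-g≡h {y} y≢ = χ-isCycleMin?-cong g h
      (λ min m → let k , e = h-orbit⊆g-orbit y≢ m in subst (λ z → toℕ y ≤ toℕ z) (sym e) (min k))
      (λ min k → case-g-orbit {k} (g-orbit⊆h-orbit y≢ k) min)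
      where
      case-g-orbit : ∀ {k} → (∃ λ m → iter h m y ≡ iter g k y ⊎ (iter g k y ≡ last × iter h m y ≡ g ⟨$⟩ʳ iter g k y)) →
        IsOrbitMin h y → toℕ y ≤ toℕ (iter g k y)
      case-g-orbit (m , inj₁ e)       min = subst (λ z → toℕ y ≤ toℕ z) e (min m)
      case-g-orbit (m , inj₂ (e , _)) min = subst (λ z → toℕ y ≤ toℕ z) (sym e) (toℕ≤toℕ-last y)

    χ-isCycleMin?-last : χ (isCycleMin? g last) ≡ χ (w FinP.≟ last)
    χ-isCycleMin?-last with w FinP.≟ last
    ... | yes e = χ-isCycleMin?-fixed g e
    ... | no w≢ = χ-no (λ min → ℕP.<⇒≱ (subst (toℕ w <_) (sym (FinP.toℕ-fromℕ n)) (≢fromℕ⇒toℕ< w w≢))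
                                         (IsCycleMin⇒IsOrbitMin g min 1)) _

  cycles-decomposition : cycles g ≡ cycles restriction + χ (w FinP.≟ last)
  cycles-decomposition = begin
    cycles g                                                              ≡⟨ cycles-∑ g ⟩
    ∑[ i < suc n ] χ (isCycleMin? g i)                                     ≡⟨ sum-init-last (λ i → χ (isCycleMin? g i)) ⟩
    ∑[ i < n ] χ (isCycleMin? g (inject₁ i)) + χ (isCycleMin? g last)
      ≡⟨ cong₂ _+_ (sum-cong-≗ λ i → trans (χ-isCycleMin?-g≡h (inject₁≢fromℕ i)) (χ-isCycleMin?-inject₁ i)) χ-isCycleMin?-last ⟩
    ∑[ i < n ] χ (isCycleMin? restriction i) + χ (w FinP.≟ last)          ≡⟨ cong (_+ χ (w FinP.≟ last)) (cycles-∑ restriction) ⟨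
    cycles restriction + χ (w FinP.≟ last)                                ∎
    where open ≡-Reasoning

private
  inversion-∘-pointwise : ∀ {x y u v} → (x ≡ 1 × y ≡ 0) ⊎ (x ≡ 0 × y ≡ 1) → (u ≡ 1 × v ≡ 0) ⊎ (u ≡ 0 × v ≡ 1) →
    1 * v + 2 * (1 * (y * u)) ≡ 1 * y + 1 * (x * v + y * u)
  inversion-∘-pointwise (inj₁ (refl , refl)) (inj₁ (refl , refl)) = refl
  inversion-∘-pointwise (inj₁ (refl , refl)) (inj₂ (refl , refl)) = refl
  inversion-∘-pointwise (inj₂ (refl , refl)) (inj₁ (refl , refl)) = refl
  inversion-∘-pointwise (inj₂ (refl , refl)) (inj₂ (refl , refl)) = refl

-- E counts the pairs i < j that g inverts and h then restores: each is an inversion of g and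
-- (as the pair g j < g i) of h, but not of g ∘ₚ h.
inversions-∘ : ∀ {n} (g h : Permutation′ n) → ∃ λ E → inversions (g ∘ₚ h) + 2 * E ≡ inversions g + inversions h
inversions-∘ {n} g h = ∑² both , (begin
  inversions (g ∘ₚ h) + 2 * ∑² both      ≡⟨ cong₂ _+_ (inversions-∑ (g ∘ₚ h)) (*-distribˡ-∑² 2 both) ⟩
  ∑² (inversion (g ∘ₚ h)) + ∑² (λ i j → 2 * both i j)
    ≡⟨ ∑²-distrib-+ (inversion (g ∘ₚ h)) (λ i j → 2 * both i j) ⟨
  ∑² (λ i j → inversion (g ∘ₚ h) i j + 2 * both i j)
    ≡⟨ sum-cong-≗ (λ i → sum-cong-≗ (pointwise i)) ⟩
  ∑² (λ i j → inversion g i j + χ< (toℕ i) (toℕ j) * D (g ⟨$⟩ʳ i) (g ⟨$⟩ʳ j))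
    ≡⟨ ∑²-distrib-+ (inversion g) (λ i j → χ< (toℕ i) (toℕ j) * D (g ⟨$⟩ʳ i) (g ⟨$⟩ʳ j)) ⟩
  ∑² (inversion g) + ∑² (λ i j → χ< (toℕ i) (toℕ j) * D (g ⟨$⟩ʳ i) (g ⟨$⟩ʳ j))
    ≡⟨ cong₂ _+_ (inversions-∑ g) (sym D-above-g) ⟨
  inversions g + inversions h ∎)
  where
  open ≡-Reasoning
  both : Fin n → Fin n → ℕ
  both i j = χ< (toℕ i) (toℕ j) *
    (χ< (toℕ (g ⟨$⟩ʳ j)) (toℕ (g ⟨$⟩ʳ i)) * χ< (toℕ (h ⟨$⟩ʳ (g ⟨$⟩ʳ i))) (toℕ (h ⟨$⟩ʳ (g ⟨$⟩ʳ j))))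

  D : Fin n → Fin n → ℕ
  D a b = χ< (toℕ a) (toℕ b) * χ< (toℕ (h ⟨$⟩ʳ b)) (toℕ (h ⟨$⟩ʳ a)) + χ< (toℕ b) (toℕ a) * χ< (toℕ (h ⟨$⟩ʳ a)) (toℕ (h ⟨$⟩ʳ b))

  D-sym : ∀ a b → D a b ≡ D b a
  D-sym a b = ℕP.+-comm (χ< (toℕ a) (toℕ b) * χ< (toℕ (h ⟨$⟩ʳ b)) (toℕ (h ⟨$⟩ʳ a))) _

  D-diag : ∀ a → D a a ≡ 0
  D-diag a rewrite χ<-irrefl (toℕ a) = refl

  D-above : ∀ a b → χ< (toℕ a) (toℕ b) * D a b ≡ inversion h a b
  D-above a b with toℕ a ℕ.<? toℕ b
  ... | no _    = refl
  ... | yes a<b rewrite χ-no (ℕP.<⇒≯ a<b) (toℕ b ℕ.<? toℕ a) = trans (ℕP.+-identityʳ _) (ℕP.+-identityʳ _)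

  toℕ-∘-injective : ∀ (p : Permutation′ n) {x y} → toℕ (p ⟨$⟩ʳ x) ≡ toℕ (p ⟨$⟩ʳ y) → toℕ x ≡ toℕ y
  toℕ-∘-injective p e = cong toℕ (perm-injective p (FinP.toℕ-injective e))

  pointwise : ∀ i j → inversion (g ∘ₚ h) i j + 2 * both i j ≡ inversion g i j + χ< (toℕ i) (toℕ j) * D (g ⟨$⟩ʳ i) (g ⟨$⟩ʳ j)
  pointwise i j with toℕ i ℕ.<? toℕ j
  ... | no _    = refl
  ... | yes i<j = inversion-∘-pointwise (χ<-cases (ℕP.<⇒≢ i<j ∘ toℕ-∘-injective g))
                                        (χ<-cases (ℕP.<⇒≢ i<j ∘ toℕ-∘-injective g ∘ toℕ-∘-injective h))

  D-above-g : ∑² (λ i j → χ< (toℕ i) (toℕ j) * D (g ⟨$⟩ʳ i) (g ⟨$⟩ʳ j)) ≡ inversions h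
  D-above-g = ℕP.*-cancelˡ-≡ _ _ 2 (begin
    2 * ∑² (λ i j → χ< (toℕ i) (toℕ j) * D (g ⟨$⟩ʳ i) (g ⟨$⟩ʳ j))
      ≡⟨ ∑²-symmetric (λ i j → D (g ⟨$⟩ʳ i) (g ⟨$⟩ʳ j)) (λ i j → D-sym (g ⟨$⟩ʳ i) (g ⟨$⟩ʳ j)) (λ i → D-diag (g ⟨$⟩ʳ i)) ⟨
    ∑² (λ i j → D (g ⟨$⟩ʳ i) (g ⟨$⟩ʳ j)) ≡⟨ sum-cong-≗ (λ i → sum-permute (D (g ⟨$⟩ʳ i)) g) ⟨
    ∑[ i < n ] ∑[ b < n ] D (g ⟨$⟩ʳ i) b ≡⟨ sum-permute (λ a → ∑[ b < n ] D a b) g ⟨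
    ∑² D                                 ≡⟨ ∑²-symmetric D D-sym D-diag ⟩
    2 * ∑² (λ a b → χ< (toℕ a) (toℕ b) * D a b) ≡⟨ cong (2 *_) (sum-cong-≗ λ a → sum-cong-≗ (D-above a)) ⟩
    2 * ∑² (inversion h)                 ≡⟨ cong (2 *_) (inversions-∑ h) ⟨
    2 * inversions h                     ∎)

parity-inversions-∘ : ∀ {n} (g h : Permutation′ n) →
  parity (inversions (g ∘ₚ h)) ≡ parity (inversions g) ℙ.+ parity (inversions h)
parity-inversions-∘ g h = let E , e = inversions-∘ g h in begin
  parity (inversions (g ∘ₚ h))                  ≡⟨ ℙP.+-identityʳ _ ⟨
  parity (inversions (g ∘ₚ h)) ℙ.+ 0ℙ            ≡⟨ cong (parity (inversions (g ∘ₚ h)) ℙ.+_) (ℙP.*-homo-* 2 E) ⟨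
  parity (inversions (g ∘ₚ h)) ℙ.+ parity (2 * E) ≡⟨ ℙP.+-homo-+ (inversions (g ∘ₚ h)) (2 * E) ⟨
  parity (inversions (g ∘ₚ h) + 2 * E)           ≡⟨ cong parity e ⟩
  parity (inversions g + inversions h)           ≡⟨ ℙP.+-homo-+ (inversions g) (inversions h) ⟩
  parity (inversions g) ℙ.+ parity (inversions h) ∎
  where open ≡-Reasoning

-- With a = toℕ w, the transposition (w L) inverts the pairs (a, j) and (j, L) for a < j < L and the
-- pair (a, L) itself: 2C + 1 inversions.
module _ {n} (w : Fin (suc n)) (w≢last : w ≢ fromℕ n) where

  private
    last = fromℕ n
    a = toℕ w
    τ = transpose w last

    a<n : a < n
    a<n = ≢fromℕ⇒toℕ< w w≢last

    τ-inject₁ : ∀ (i : Fin n) →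
      (toℕ i ≡ a × toℕ (τ ⟨$⟩ʳ inject₁ i) ≡ n) ⊎ (toℕ i ≢ a × toℕ (τ ⟨$⟩ʳ inject₁ i) ≡ toℕ i)
    τ-inject₁ i with toℕ i ℕP.≟ a
    ... | yes e = inj₁ (e , trans (cong (toℕ ∘ PC.transpose w last) (FinP.toℕ-injective (trans (FinP.toℕ-inject₁ i) e)))
                                  (trans (cong toℕ (transpose-matchˡ w last)) (FinP.toℕ-fromℕ n)))
    ... | no e  = inj₂ (e , trans (cong toℕ (transpose-noMatch w last (e ∘ trans (sym (FinP.toℕ-inject₁ i)) ∘ cong toℕ) (inject₁≢fromℕ i)))
                                  (FinP.toℕ-inject₁ i))

    inner-entry : ∀ x y tx ty → x < n → y < n →
      (x ≡ a × tx ≡ n) ⊎ (x ≢ a × tx ≡ x) → (y ≡ a × ty ≡ n) ⊎ (y ≢ a × ty ≡ y) →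
      χ< x y * χ< ty tx ≡ χ (x ℕP.≟ a) * χ< x y
    inner-entry x y _ _ _ _   (inj₁ (refl , refl)) (inj₁ (refl , refl)) rewrite χ<-irrefl x = sym (ℕP.*-zeroʳ (χ (x ℕP.≟ x)))
    inner-entry x y _ _ _ y<n (inj₁ (refl , refl)) (inj₂ (_ , refl)) rewrite χ-yes y<n (y ℕ.<? n) | χ-yes refl (x ℕP.≟ x) =
      trans (ℕP.*-identityʳ _) (sym (ℕP.+-identityʳ _))
    inner-entry x y _ _ x<n _ (inj₂ (x≢a , refl)) y-case rewrite χ-no x≢a (x ℕP.≟ a) with x ℕ.<? y
    ... | no _ = refl
    ... | yes x<y with y-case
    ...   | inj₁ (_ , refl) = cong (_+ 0) (χ-no (ℕP.<⇒≯ x<n) _)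
    ...   | inj₂ (_ , refl) = cong (_+ 0) (χ-no (ℕP.<⇒≯ x<y) _)

    last-entry : ∀ x tx → x < n → (x ≡ a × tx ≡ n) ⊎ (x ≢ a × tx ≡ x) → χ< x n * χ< a tx ≡ χ< a x + χ (x ℕP.≟ a)
    last-entry x _ x<n (inj₁ (refl , refl)) rewrite χ-yes x<n (x ℕ.<? n) | χ<-irrefl x | χ-yes refl (x ℕP.≟ x) = refl
    last-entry x _ x<n (inj₂ (x≢a , refl)) rewrite χ-yes x<n (x ℕ.<? n) | χ-no x≢a (x ℕP.≟ a) =
      trans (ℕP.+-identityʳ _) (sym (ℕP.+-identityʳ _))

    C : ℕ
    C = ∑[ j < n ] χ< a (toℕ j)

    inversions-τ : inversions τ ≡ suc (C + C)
    inversions-τ = begin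
      inversions τ        ≡⟨ inversions-∑ τ ⟩
      ∑² (inversion τ)    ≡⟨ ∑²-init-last (inversion τ) ⟩
      ∑² (λ i j → inversion τ (inject₁ i) (inject₁ j)) + ∑[ i < n ] inversion τ (inject₁ i) last + ∑[ j < suc n ] inversion τ last j
        ≡⟨ cong₂ _+_ (cong₂ _+_ (sum-cong-≗ λ i → sum-cong-≗ (inner i)) (sum-cong-≗ last-column)) (sum-zero (inversion-fromℕ τ)) ⟩
      ∑² {n} (λ i j → χ (toℕ i ℕP.≟ a) * χ< (toℕ i) (toℕ j)) + ∑[ i < n ] (χ< a (toℕ i) + χ (toℕ i ℕP.≟ a)) + 0
        ≡⟨ ℕP.+-identityʳ _ ⟩
      ∑² {n} (λ i j → χ (toℕ i ℕP.≟ a) * χ< (toℕ i) (toℕ j)) + ∑[ i < n ] (χ< a (toℕ i) + χ (toℕ i ℕP.≟ a))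
        ≡⟨ cong₂ _+_ row-a (trans (∑-distrib-+ {n} (λ i → χ< a (toℕ i)) (λ i → χ (toℕ i ℕP.≟ a))) (cong (_+_ C) count-a)) ⟩
      C + (C + 1)         ≡⟨ cong (_+_ C) (ℕP.+-comm C 1) ⟩
      C + suc C           ≡⟨ ℕP.+-suc C C ⟩
      suc (C + C)         ∎
      where
      open ≡-Reasoning
      inner : ∀ i j → inversion τ (inject₁ i) (inject₁ j) ≡ χ (toℕ i ℕP.≟ a) * χ< (toℕ i) (toℕ j)
      inner i j rewrite FinP.toℕ-inject₁ i | FinP.toℕ-inject₁ j =
        inner-entry (toℕ i) (toℕ j) _ _ (FinP.toℕ<n i) (FinP.toℕ<n j) (τ-inject₁ i) (τ-inject₁ j)
      last-column : ∀ i → inversion τ (inject₁ i) last ≡ χ< a (toℕ i) + χ (toℕ i ℕP.≟ a)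
      last-column i rewrite FinP.toℕ-inject₁ i | FinP.toℕ-fromℕ n | transpose-matchʳ w last =
        last-entry (toℕ i) _ (FinP.toℕ<n i) (τ-inject₁ i)
      row-a : ∑² {n} (λ i j → χ (toℕ i ℕP.≟ a) * χ< (toℕ i) (toℕ j)) ≡ C
      row-a = trans (sum-cong-≗ {n} λ i → sym (*-distribˡ-sum {n} (χ (toℕ i ℕP.≟ a)) (λ j → χ< (toℕ i) (toℕ j))))
                    (sum-δ a<n (λ k → ∑[ j < n ] χ< k (toℕ j)))
      count-a : ∑[ i < n ] χ (toℕ i ℕP.≟ a) ≡ 1
      count-a = trans (sum-cong-≗ {n} λ i → sym (ℕP.*-identityʳ (χ (toℕ i ℕP.≟ a)))) (sum-δ a<n (λ _ → 1))

  transpose-last-odd : parity (inversions τ) ≡ 1ℙ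
  transpose-last-odd = begin
    parity (inversions τ)             ≡⟨ cong parity inversions-τ ⟩
    parity (1 + (C + C))             ≡⟨ ℙP.+-homo-+ 1 (C + C) ⟩
    1ℙ ℙ.+ parity (C + C)            ≡⟨ cong (1ℙ ℙ.+_) (trans (ℙP.+-homo-+ C C) (ℙP.p+p≡0ℙ (parity C))) ⟩
    1ℙ                               ∎
    where open ≡-Reasoning

cycles-parity : ∀ n (g : Permutation′ n) → parity (cycles g) ≡ parity n ℙ.+ parity (inversions g)
cycles-parity zero    g = refl
cycles-parity (suc n) g = cases (w FinP.≟ last) cycles-decomposition
  where
  open Decomposition g
  open ≡-Reasoning
  g′ = restriction

  shift : ∀ q → 1ℙ ℙ.+ parity n ℙ.+ q ≡ parity (suc n) ℙ.+ q
  shift q = cong (ℙ._+ q) (sym (ℙP.+-homo-+ 1 n))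

  cases : (d : Dec (w ≡ last)) → cycles g ≡ cycles g′ + χ d → parity (cycles g) ≡ parity (suc n) ℙ.+ parity (inversions g)
  cases (yes w≡last) cycles-g = begin
    parity (cycles g)                          ≡⟨ cong parity cycles-g ⟩
    parity (cycles g′ + 1)                     ≡⟨ ℙP.+-homo-+ (cycles g′) 1 ⟩
    parity (cycles g′) ℙ.+ 1ℙ                  ≡⟨ cong (ℙ._+ 1ℙ) (cycles-parity n g′) ⟩
    parity n ℙ.+ parity (inversions g′) ℙ.+ 1ℙ ≡⟨ rearrange (parity n) (parity (inversions g′)) ⟩
    1ℙ ℙ.+ parity n ℙ.+ parity (inversions g′) ≡⟨ shift (parity (inversions g′)) ⟩
    parity (suc n) ℙ.+ parity (inversions g′)  ≡⟨ cong (λ m → parity (suc n) ℙ.+ parity m) inversions-g ⟨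
    parity (suc n) ℙ.+ parity (inversions g)   ∎
    where
    inversions-g : inversions g ≡ inversions g′
    inversions-g = trans (inversions-cong {g = g} {h} (w≡last⇒g≈h w≡last)) inversions-restriction
    rearrange : ∀ p q → p ℙ.+ q ℙ.+ 1ℙ ≡ 1ℙ ℙ.+ p ℙ.+ q
    rearrange 0ℙ q  = ℙP.+-comm q 1ℙ
    rearrange 1ℙ 0ℙ = refl
    rearrange 1ℙ 1ℙ = refl
  cases (no w≢last) cycles-g = begin
    parity (cycles g)                          ≡⟨ cong parity (trans cycles-g (ℕP.+-identityʳ (cycles g′))) ⟩
    parity (cycles g′)                         ≡⟨ cycles-parity n g′ ⟩
    parity n ℙ.+ parity (inversions g′)        ≡⟨ rearrange (parity n) (parity (inversions g′)) ⟩
    1ℙ ℙ.+ parity n ℙ.+ (parity (inversions g′) ℙ.+ 1ℙ) ≡⟨ shift (parity (inversions g′) ℙ.+ 1ℙ) ⟩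
    parity (suc n) ℙ.+ (parity (inversions g′) ℙ.+ 1ℙ) ≡⟨ cong (parity (suc n) ℙ.+_) parity-inversions-g ⟨
    parity (suc n) ℙ.+ parity (inversions g)   ∎
    where
    parity-inversions-g : parity (inversions g) ≡ parity (inversions g′) ℙ.+ 1ℙ
    parity-inversions-g = begin
      parity (inversions g)                           ≡⟨ cong parity (inversions-cong {g = g} {h ∘ₚ τ} g≈h∘τ) ⟩
      parity (inversions (h ∘ₚ τ))                    ≡⟨ parity-inversions-∘ h τ ⟩
      parity (inversions h) ℙ.+ parity (inversions τ) ≡⟨ cong₂ ℙ._+_ (cong parity inversions-restriction) (transpose-last-odd w w≢last) ⟩
      parity (inversions g′) ℙ.+ 1ℙ                   ∎
    rearrange : ∀ p q → p ℙ.+ q ≡ 1ℙ ℙ.+ p ℙ.+ (q ℙ.+ 1ℙ)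
    rearrange 0ℙ 0ℙ = refl
    rearrange 0ℙ 1ℙ = refl
    rearrange 1ℙ 0ℙ = refl
    rearrange 1ℙ 1ℙ = refl

snoc : ∀ {n k} → (Fin n → Fin k) → Fin k → Fin (suc n) → Fin k
snoc {zero}  f c zero    = c
snoc {suc n} f c zero    = f zero
snoc {suc n} f c (suc x) = snoc (f ∘ suc) c x

snoc-inject₁ : ∀ {n k} (f : Fin n → Fin k) c x → snoc f c (inject₁ x) ≡ f x
snoc-inject₁ {suc n} f c zero    = refl
snoc-inject₁ {suc n} f c (suc x) = snoc-inject₁ (f ∘ suc) c x

snoc-last : ∀ {n k} (f : Fin n → Fin k) c → snoc f c (fromℕ n) ≡ c
snoc-last {zero}  f c = refl
snoc-last {suc n} f c = snoc-last (f ∘ suc) c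

snoc-init-last : ∀ {n k} (f : Fin (suc n) → Fin k) x → snoc (f ∘ inject₁) (f (fromℕ n)) x ≡ f x
snoc-init-last {zero}  f zero    = refl
snoc-init-last {suc n} f zero    = refl
snoc-init-last {suc n} f (suc x) = snoc-init-last (f ∘ suc) x

snoc-cong : ∀ {n k} {f f′ : Fin n → Fin k} → f ≗ f′ → ∀ c → snoc f c ≗ snoc f′ c
snoc-cong {zero}  e c zero    = refl
snoc-cong {suc n} e c zero    = e zero
snoc-cong {suc n} e c (suc x) = snoc-cong (e ∘ suc) c x

module ColouringSum {c ℓ} (R : Semiring c ℓ) where

  private module R = Semiring R
  open R using (Carrier; _≈_; 0#; zeroˡ) renaming (_+_ to _⊕_; _*_ to _⊛_)
  private module Σ = SemiringSum R
  open Σ using () renaming (sum to ⨁)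
  open import Relation.Binary.Reasoning.Setoid R.setoid

  ∑ᶜ : ∀ n k → ((Fin n → Fin k) → Carrier) → Carrier
  ∑ᶜ zero    k φ = φ (λ ())
  ∑ᶜ (suc n) k φ = ∑ᶜ n k (λ f → ⨁ (λ c → φ (snoc f c)))

  ∑ᶜ-cong : ∀ n k {φ ψ : (Fin n → Fin k) → Carrier} → (∀ f → φ f ≈ ψ f) → ∑ᶜ n k φ ≈ ∑ᶜ n k ψ
  ∑ᶜ-cong zero    k e = e _
  ∑ᶜ-cong (suc n) k e = ∑ᶜ-cong n k (λ f → Σ.sum-cong-≋ (λ c → e (snoc f c)))

  ∑ᶜ-distrib-+ : ∀ n k (φ ψ : (Fin n → Fin k) → Carrier) → ∑ᶜ n k (λ f → φ f ⊕ ψ f) ≈ ∑ᶜ n k φ ⊕ ∑ᶜ n k ψ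
  ∑ᶜ-distrib-+ zero    k φ ψ = R.refl
  ∑ᶜ-distrib-+ (suc n) k φ ψ = R.trans
    (∑ᶜ-cong n k (λ f → Σ.∑-distrib-+ (λ c → φ (snoc f c)) (λ c → ψ (snoc f c))))
    (∑ᶜ-distrib-+ n k (λ f → ⨁ (λ c → φ (snoc f c))) (λ f → ⨁ (λ c → ψ (snoc f c))))

  *-distribˡ-∑ᶜ : ∀ n k x (φ : (Fin n → Fin k) → Carrier) → x ⊛ ∑ᶜ n k φ ≈ ∑ᶜ n k (λ f → x ⊛ φ f)
  *-distribˡ-∑ᶜ zero    k x φ = R.refl
  *-distribˡ-∑ᶜ (suc n) k x φ = R.trans (*-distribˡ-∑ᶜ n k x (λ f → ⨁ (λ c → φ (snoc f c))))
    (∑ᶜ-cong n k (λ f → Σ.*-distribˡ-sum x (λ c → φ (snoc f c))))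

  ∑ᶜ-zero : ∀ n k → ∑ᶜ n k (λ _ → 0#) ≈ 0#
  ∑ᶜ-zero n k = begin
    ∑ᶜ n k (λ _ → 0#)      ≈⟨ ∑ᶜ-cong n k (λ _ → zeroˡ 0#) ⟨
    ∑ᶜ n k (λ _ → 0# ⊛ 0#) ≈⟨ *-distribˡ-∑ᶜ n k 0# (λ _ → 0#) ⟨
    0# ⊛ ∑ᶜ n k (λ _ → 0#) ≈⟨ zeroˡ _ ⟩
    0#                     ∎

module ℕᶜ = ColouringSum ℕP.+-*-semiring

module ℤᶜ = ColouringSum ZP.+-*-semiring

∑ᶜ-pos : ∀ n k (φ : (Fin n → Fin k) → ℕ) → ℤᶜ.∑ᶜ n k (λ f → + φ f) ≡ + ℕᶜ.∑ᶜ n k φ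
∑ᶜ-pos zero    k φ = refl
∑ᶜ-pos (suc n) k φ = trans (ℤᶜ.∑ᶜ-cong n k (λ f → sum-pos (λ c → φ (snoc f c)))) (∑ᶜ-pos n k (λ f → ∑[ c < k ] φ (snoc f c)))

-- ∑ᶜ visits a single colouring of each ≗-class, hence the hypothesis on φ.
∑ᶜ≡0⇒ : ∀ n k (φ : (Fin n → Fin k) → ℕ) → (∀ {f f′} → f ≗ f′ → φ f ≡ φ f′) → ℕᶜ.∑ᶜ n k φ ≡ 0 → ∀ f → φ f ≡ 0
∑ᶜ≡0⇒ zero    k φ φ-cong e f = trans (φ-cong (λ ())) e
∑ᶜ≡0⇒ (suc n) k φ φ-cong e f = trans (φ-cong (sym ∘ snoc-init-last f))
  (sum≡0⇒ (λ c → φ (snoc (f ∘ inject₁) c))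
    (∑ᶜ≡0⇒ n k (λ f′ → ∑[ c < k ] φ (snoc f′ c)) (λ e′ → sum-cong-≗ (λ c → φ-cong (snoc-cong e′ c))) e (f ∘ inject₁))
    (f (fromℕ n)))

Fixes : ∀ {n k} → Permutation′ n → (Fin n → Fin k) → Set
Fixes g f = ∀ x → f (g ⟨$⟩ʳ x) ≡ f x

fixes? : ∀ {n k} (g : Permutation′ n) (f : Fin n → Fin k) → Dec (Fixes g f)
fixes? g f = FinP.all? (λ x → f (g ⟨$⟩ʳ x) FinP.≟ f x)

Fixes-≗ : ∀ {n k} (g : Permutation′ n) {f f′ : Fin n → Fin k} → f ≗ f′ → Fixes g f → Fixes g f′
Fixes-≗ g e fixes x = trans (sym (e _)) (trans (fixes x) (e x))

Fixes-≈ₚ : ∀ {n k} {g g′ : Permutation′ n} (f : Fin n → Fin k) → g ≈ₚ g′ → Fixes g f → Fixes g′ f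
Fixes-≈ₚ f e fixes x = trans (cong f (sym (e x))) (fixes x)

#fixedColourings : ∀ {n} → Permutation′ n → ℕ → ℕ
#fixedColourings {n} g k = ℕᶜ.∑ᶜ n k (λ f → χ (fixes? g f))

module _ {n k : ℕ} (g : Permutation′ (suc n)) where

  open Decomposition g

  private
    Fixes-h⇔ : (f⁺ : Fin (suc n) → Fin k) → Fixes h f⁺ ⇔ Fixes restriction (f⁺ ∘ inject₁)
    Fixes-h⇔ f⁺ = mk⇔ (λ fixes x → trans (cong f⁺ (restriction-inject₁ x)) (fixes (inject₁ x))) from
      where
      from : Fixes restriction (f⁺ ∘ inject₁) → Fixes h f⁺
      from fixes x with view x
      ... | ‵fromℕ     = cong f⁺ h-last
      ... | ‵inject₁ y = trans (cong f⁺ (sym (restriction-inject₁ y))) (fixes y)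

    Fixes-g⇔ : (f⁺ : Fin (suc n) → Fin k) → Fixes g f⁺ ⇔ (Fixes h f⁺ × f⁺ w ≡ f⁺ last)
    Fixes-g⇔ f⁺ = mk⇔
      (λ fixes → let f⁺w≡f⁺last = fixes last in
        (λ x → trans (transpose-same w last f⁺ f⁺w≡f⁺last (g ⟨$⟩ʳ x)) (fixes x)) , f⁺w≡f⁺last)
      (λ (fixes , f⁺w≡f⁺last) x → trans (cong f⁺ (g≈h∘τ x)) (trans (transpose-same w last f⁺ f⁺w≡f⁺last (h ⟨$⟩ʳ x)) (fixes x)))

  χ-fixes?-snoc : ∀ (f : Fin n → Fin k) c →
    χ (fixes? g (snoc f c)) ≡ χ (fixes? restriction f) * χ (snoc f c w FinP.≟ c)
  χ-fixes?-snoc f c = trans (χ-cong to from _ (fixes? restriction f ×-dec (snoc f c w FinP.≟ c)))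
                            (χ-× (fixes? restriction f) (snoc f c w FinP.≟ c))
    where
    f⁺ = snoc f c
    to : Fixes g f⁺ → Fixes restriction f × f⁺ w ≡ c
    to fixes = let fixes-h , f⁺w≡f⁺last = Equivalence.to (Fixes-g⇔ f⁺) fixes in
      Fixes-≗ restriction (snoc-inject₁ f c) (Equivalence.to (Fixes-h⇔ f⁺) fixes-h) , trans f⁺w≡f⁺last (snoc-last f c)
    from : Fixes restriction f × f⁺ w ≡ c → Fixes g f⁺
    from (fixes , f⁺w≡c) = Equivalence.from (Fixes-g⇔ f⁺)
      (Equivalence.from (Fixes-h⇔ f⁺) (Fixes-≗ restriction (sym ∘ snoc-inject₁ f c) fixes) , trans f⁺w≡c (sym (snoc-last f c)))

#fixedColourings≡^cycles : ∀ n (g : Permutation′ n) k → #fixedColourings g k ≡ k ^ cycles g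
#fixedColourings≡^cycles zero    g k = χ-yes (λ ()) (fixes? {k = k} g (λ ()))
#fixedColourings≡^cycles (suc n) g k = begin
  #fixedColourings g k
    ≡⟨ ℕᶜ.∑ᶜ-cong n k (λ f → sum-cong-≗ (χ-fixes?-snoc g f)) ⟩
  ℕᶜ.∑ᶜ n k (λ f → ∑[ c < k ] (χ (fixes? g′ f) * χ (snoc f c w FinP.≟ c)))
    ≡⟨ ℕᶜ.∑ᶜ-cong n k (λ f → sym (*-distribˡ-sum (χ (fixes? g′ f)) (λ c → χ (snoc f c w FinP.≟ c)))) ⟩
  ℕᶜ.∑ᶜ n k (λ f → χ (fixes? g′ f) * ∑[ c < k ] χ (snoc f c w FinP.≟ c))
    ≡⟨ cases (w FinP.≟ last) cycles-decomposition ⟩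
  k ^ cycles g ∎
  where
  open ≡-Reasoning
  open Decomposition g
  g′ = restriction
  IH = #fixedColourings≡^cycles n g′ k

  cases : (d : Dec (w ≡ last)) → cycles g ≡ cycles g′ + χ d →
    ℕᶜ.∑ᶜ n k (λ f → χ (fixes? g′ f) * ∑[ c < k ] χ (snoc f c w FinP.≟ c)) ≡ k ^ cycles g
  cases (yes w≡last) cycles-g = begin
    ℕᶜ.∑ᶜ n k (λ f → χ (fixes? g′ f) * ∑[ c < k ] χ (snoc f c w FinP.≟ c))
      ≡⟨ ℕᶜ.∑ᶜ-cong n k (λ f → cong (χ (fixes? g′ f) *_) (inner f)) ⟩
    ℕᶜ.∑ᶜ n k (λ f → χ (fixes? g′ f) * k) ≡⟨ ℕᶜ.∑ᶜ-cong n k (λ f → ℕP.*-comm (χ (fixes? g′ f)) k) ⟩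
    ℕᶜ.∑ᶜ n k (λ f → k * χ (fixes? g′ f)) ≡⟨ ℕᶜ.*-distribˡ-∑ᶜ n k k (λ f → χ (fixes? g′ f)) ⟨
    k * #fixedColourings g′ k             ≡⟨ cong (k *_) IH ⟩
    k ^ suc (cycles g′)                   ≡⟨ cong (k ^_) (ℕP.+-comm 1 (cycles g′)) ⟩
    k ^ (cycles g′ + 1)                   ≡⟨ cong (k ^_) cycles-g ⟨
    k ^ cycles g                          ∎
    where
    inner : ∀ f → ∑[ c < k ] χ (snoc f c w FinP.≟ c) ≡ k
    inner f = trans (sum-cong-≗ λ c → χ-yes (trans (cong (snoc f c) w≡last) (snoc-last f c)) (snoc f c w FinP.≟ c)) (sum-1 k)
  cases (no w≢last) cycles-g = begin
    ℕᶜ.∑ᶜ n k (λ f → χ (fixes? g′ f) * ∑[ c < k ] χ (snoc f c w FinP.≟ c))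
      ≡⟨ ℕᶜ.∑ᶜ-cong n k (λ f → trans (cong (χ (fixes? g′ f) *_) (inner (proj₂ (≢fromℕ⇒inject₁ w w≢last)) f)) (ℕP.*-identityʳ _)) ⟩
    #fixedColourings g′ k                 ≡⟨ IH ⟩
    k ^ cycles g′                         ≡⟨ cong (k ^_) (trans cycles-g (ℕP.+-identityʳ _)) ⟨
    k ^ cycles g                          ∎
    where
    inner : ∀ {w′} → w ≡ inject₁ w′ → ∀ f → ∑[ c < k ] χ (snoc f c w FinP.≟ c) ≡ 1
    inner {w′} w≡w′ f = trans (sum-cong-≗ λ c → χ-cong (trans (sym (e c))) (trans (e c)) _ (f w′ FinP.≟ c)) (sum-χ≟ (f w′))
      where
      e : ∀ c → snoc f c w ≡ f w′
      e c = trans (cong (snoc f c) w≡w′) (snoc-inject₁ f c w′)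

∑ₗ : ∀ {a} {A : Set a} → List A → (A → ℤ) → ℤ
∑ₗ xs ψ = sumℤ (map ψ xs)

module _ {a} {A : Set a} where

  ∑ₗ-cong : ∀ (xs : List A) {ψ φ : A → ℤ} → (∀ x → ψ x ≡ φ x) → ∑ₗ xs ψ ≡ ∑ₗ xs φ
  ∑ₗ-cong []       e = refl
  ∑ₗ-cong (x ∷ xs) e = cong₂ _+ℤ_ (e x) (∑ₗ-cong xs e)

  ∑ₗ-congᴬ : ∀ {xs : List A} {ψ φ : A → ℤ} → All (λ x → ψ x ≡ φ x) xs → ∑ₗ xs ψ ≡ ∑ₗ xs φ
  ∑ₗ-congᴬ []       = refl
  ∑ₗ-congᴬ (e ∷ es) = cong₂ _+ℤ_ e (∑ₗ-congᴬ es)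

  ∑ₗ-zero : ∀ (xs : List A) → ∑ₗ xs (λ _ → + 0) ≡ + 0
  ∑ₗ-zero []       = refl
  ∑ₗ-zero (x ∷ xs) = trans (ZP.+-identityˡ _) (∑ₗ-zero xs)

  ∑ₗ-*ʳ : ∀ (xs : List A) (ψ : A → ℤ) c → ∑ₗ xs (λ x → ψ x *ℤ c) ≡ ∑ₗ xs ψ *ℤ c
  ∑ₗ-*ʳ []       ψ c = sym (ZP.*-zeroˡ c)
  ∑ₗ-*ʳ (x ∷ xs) ψ c = trans (cong (ψ x *ℤ c +ℤ_) (∑ₗ-*ʳ xs ψ c)) (sym (ZP.*-distribʳ-+ c (ψ x) (∑ₗ xs ψ)))

  ∑ₗ-neg : ∀ (xs : List A) (ψ : A → ℤ) → ∑ₗ xs (λ x → - ψ x) ≡ - ∑ₗ xs ψ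
  ∑ₗ-neg []       ψ = refl
  ∑ₗ-neg (x ∷ xs) ψ = trans (cong (- ψ x +ℤ_) (∑ₗ-neg xs ψ)) (sym (ZP.neg-distrib-+ (ψ x) (∑ₗ xs ψ)))

  ∑ₗ-distrib-+ : ∀ (xs : List A) (ψ φ : A → ℤ) → ∑ₗ xs (λ x → ψ x +ℤ φ x) ≡ ∑ₗ xs ψ +ℤ ∑ₗ xs φ
  ∑ₗ-distrib-+ []       ψ φ = refl
  ∑ₗ-distrib-+ (x ∷ xs) ψ φ = trans (cong (ψ x +ℤ φ x +ℤ_) (∑ₗ-distrib-+ xs ψ φ))
    (+-interchange (ψ x) (φ x) (∑ₗ xs ψ) (∑ₗ xs φ))

  ∑ₗ-pos : ∀ (xs : List A) (φ : A → ℕ) → ∑ₗ xs (λ x → + φ x) ≡ + sumₗ (map φ xs)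
  ∑ₗ-pos []       φ = refl
  ∑ₗ-pos (x ∷ xs) φ = trans (cong (+ φ x +ℤ_) (∑ₗ-pos xs φ)) (sym (ZP.pos-+ (φ x) _))

∑ₗ-comm : ∀ {a b} {A : Set a} {B : Set b} (xs : List A) (ys : List B) (φ : A → B → ℤ) →
  ∑ₗ xs (λ x → ∑ₗ ys (φ x)) ≡ ∑ₗ ys (λ y → ∑ₗ xs (λ x → φ x y))
∑ₗ-comm []       ys φ = sym (∑ₗ-zero ys)
∑ₗ-comm (x ∷ xs) ys φ = trans (cong (∑ₗ ys (φ x) +ℤ_) (∑ₗ-comm xs ys φ))
  (sym (∑ₗ-distrib-+ ys (φ x) (λ y → ∑ₗ xs (λ x′ → φ x′ y))))

∑ᶜ-∑ₗ : ∀ {a} {A : Set a} n k (xs : List A) (ψ : A → (Fin n → Fin k) → ℤ) →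
  ℤᶜ.∑ᶜ n k (λ f → ∑ₗ xs (λ x → ψ x f)) ≡ ∑ₗ xs (λ x → ℤᶜ.∑ᶜ n k (ψ x))
∑ᶜ-∑ₗ n k []       ψ = ℤᶜ.∑ᶜ-zero n k
∑ᶜ-∑ₗ n k (x ∷ xs) ψ = trans (ℤᶜ.∑ᶜ-distrib-+ n k (ψ x) (λ f → ∑ₗ xs (λ y → ψ y f)))
  (cong (ℤᶜ.∑ᶜ n k (ψ x) +ℤ_) (∑ᶜ-∑ₗ n k xs ψ))

Any⇒∈ₚ : ∀ {n p} {P : Permutation′ n → Set p} {xs} → Any P xs → ∃ λ g → g ∈ₚ xs × P g
Any⇒∈ₚ (here p)  = _ , here (λ _ → refl) , p
Any⇒∈ₚ (there a) = let g , g∈xs , p = Any⇒∈ₚ a in g , there g∈xs , p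

δ : ∀ {n} → Permutation′ n → Permutation′ n → ℤ
δ g x = + χ (g ≈ₚ? x)

∈ₚ-self : ∀ {n} (xs : List (Permutation′ n)) → All (_∈ₚ xs) xs
∈ₚ-self []       = []
∈ₚ-self (x ∷ xs) = here (λ _ → refl) ∷ All.map there (∈ₚ-self xs)

∑ₗ-δ : ∀ {n} {xs : List (Permutation′ n)} → AllPairs (λ g h → ¬ (g ≈ₚ h)) xs → ∀ {x} → x ∈ₚ xs → ∑ₗ xs (λ g → δ g x) ≡ + 1
∑ₗ-δ {xs = y ∷ ys} (y≉ys ∷ _) {x} (here x≈y) = cong₂ _+ℤ_ (cong +_ (χ-yes (λ i → sym (x≈y i)) (y ≈ₚ? x)))
  (trans (∑ₗ-congᴬ (All.map (λ y≉z → cong +_ (χ-no (λ z≈x → y≉z λ i → trans (sym (x≈y i)) (sym (z≈x i))) _)) y≉ys)) (∑ₗ-zero ys))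
∑ₗ-δ {xs = y ∷ ys} (y≉ys ∷ distinct) {x} (there x∈ys) = cong₂ _+ℤ_ (cong +_ (χ-no y≉x (y ≈ₚ? x))) (∑ₗ-δ distinct {x} x∈ys)
  where
  y≉x : ¬ (y ≈ₚ x)
  y≉x y≈x = AllP.All¬⇒¬Any (All.map (λ y≉z x≈z → y≉z λ i → trans (y≈x i) (x≈z i)) y≉ys) x∈ys

module _ {n} {G : List (Permutation′ n)} (G-group : IsPermGroup G) where

  open IsPermGroup G-group

  ∑ₗ-select : ∀ {ψ : Permutation′ n → ℤ} → ψ Preserves _≈ₚ_ ⟶ _≡_ → ∀ {x} → x ∈ₚ G → ∑ₗ G (λ g → δ g x *ℤ ψ g) ≡ ψ x
  ∑ₗ-select {ψ} ψ-resp {x} x∈G = begin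
    ∑ₗ G (λ g → δ g x *ℤ ψ g) ≡⟨ ∑ₗ-cong G (λ g → select g (g ≈ₚ? x)) ⟩
    ∑ₗ G (λ g → δ g x *ℤ ψ x) ≡⟨ ∑ₗ-*ʳ G (λ g → δ g x) (ψ x) ⟩
    ∑ₗ G (λ g → δ g x) *ℤ ψ x ≡⟨ cong (_*ℤ ψ x) (∑ₗ-δ distinct {x} x∈G) ⟩
    + 1 *ℤ ψ x               ≡⟨ ZP.*-identityˡ (ψ x) ⟩
    ψ x                      ∎
    where
    open ≡-Reasoning
    select : ∀ g (d : Dec (g ≈ₚ x)) → + χ d *ℤ ψ g ≡ + χ d *ℤ ψ x
    select g (yes g≈x) = cong (+ 1 *ℤ_) (ψ-resp g≈x)
    select g (no _)    = trans (ZP.*-zeroˡ (ψ g)) (sym (ZP.*-zeroˡ (ψ x)))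

  -- G is only a list, so instead of reindexing along g ↦ g ∘ₚ h each term is expanded by ∑ₗ-select
  -- and the two sums over G are exchanged.
  ∑ₗ-translate : ∀ {ψ : Permutation′ n → ℤ} → ψ Preserves _≈ₚ_ ⟶ _≡_ →
    ∀ {h} → h ∈ₚ G → ∑ₗ G (λ g → ψ (g ∘ₚ h)) ≡ ∑ₗ G ψ
  ∑ₗ-translate {ψ} ψ-resp {h} h∈G = begin
    ∑ₗ G (λ g → ψ (g ∘ₚ h))                          ≡⟨ ∑ₗ-congᴬ (All.map (λ {g} → expand {g}) (∈ₚ-self G)) ⟩
    ∑ₗ G (λ g → ∑ₗ G (λ g′ → δ g′ (g ∘ₚ h) *ℤ ψ g′)) ≡⟨ ∑ₗ-comm G G (λ g g′ → δ g′ (g ∘ₚ h) *ℤ ψ g′) ⟩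
    ∑ₗ G (λ g′ → ∑ₗ G (λ g → δ g′ (g ∘ₚ h) *ℤ ψ g′)) ≡⟨ ∑ₗ-cong G (λ g′ → ∑ₗ-*ʳ G (λ g → δ g′ (g ∘ₚ h)) (ψ g′)) ⟩
    ∑ₗ G (λ g′ → ∑ₗ G (λ g → δ g′ (g ∘ₚ h)) *ℤ ψ g′) ≡⟨ ∑ₗ-congᴬ (All.map (λ {g′} g′∈G → cong (_*ℤ ψ g′) (collapse {g′} g′∈G)) (∈ₚ-self G)) ⟩
    ∑ₗ G (λ g′ → + 1 *ℤ ψ g′)                        ≡⟨ ∑ₗ-cong G (λ g′ → ZP.*-identityˡ (ψ g′)) ⟩
    ∑ₗ G ψ                                           ∎
    where
    open ≡-Reasoning
    expand : ∀ {g} → g ∈ₚ G → ψ (g ∘ₚ h) ≡ ∑ₗ G (λ g′ → δ g′ (g ∘ₚ h) *ℤ ψ g′)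
    expand {g} g∈G = sym (∑ₗ-select ψ-resp {g ∘ₚ h} (closed∘ {g} {h} g∈G h∈G))
    collapse : ∀ {g′} → g′ ∈ₚ G → ∑ₗ G (λ g → δ g′ (g ∘ₚ h)) ≡ + 1
    collapse {g′} g′∈G = trans (∑ₗ-cong G (λ g → cong +_ (χ-cong (to g) (from g) _ (g ≈ₚ? (g′ ∘ₚ flip h)))))
                               (∑ₗ-δ distinct {g′ ∘ₚ flip h} (closed∘ {g′} {flip h} g′∈G (closedInv {h} h∈G)))
      where
      to : ∀ g → g′ ≈ₚ (g ∘ₚ h) → g ≈ₚ (g′ ∘ₚ flip h)
      to g e i = sym (trans (cong (h ⟨$⟩ˡ_) (e i)) (inverseˡ h))
      from : ∀ g → g ≈ₚ (g′ ∘ₚ flip h) → g′ ≈ₚ (g ∘ₚ h)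
      from g e i = trans (sym (inverseʳ h)) (cong (h ⟨$⟩ʳ_) (sym (e i)))

module SignedCount {n} {G : List (Permutation′ n)} (G-group : IsPermGroup G) where

  open IsPermGroup G-group

  HasOddFixer : ∀ {k} → (Fin n → Fin k) → Set
  HasOddFixer f = Any (λ g → Fixes g f × OddParity g) G

  hasOddFixer? : ∀ {k} (f : Fin n → Fin k) → Dec (HasOddFixer f)
  hasOddFixer? f = Any.any? (λ g → fixes? g f ×-dec (parity (inversions g) ℙP.≟ 1ℙ)) G

  #fixers : ∀ {k} → (Fin n → Fin k) → ℕ
  #fixers f = sumₗ (map (λ g → χ (fixes? g f)) G)

  -- the contribution of a colouring f to F_G(-k), up to the global sign (-1)^n
  weight : ∀ {k} → (Fin n → Fin k) → ℕ
  weight f with hasOddFixer? f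
  ... | yes _ = 0
  ... | no _  = #fixers f

  signedFixers : ∀ {k} → (Fin n → Fin k) → ℤ
  signedFixers f = ∑ₗ G (λ g → + χ (fixes? g f) *ℤ sign (parity (cycles g)))

  private
    sign-cycles : ∀ g → sign (parity (cycles g)) ≡ sign (parity n ℙ.+ parity (inversions g))
    sign-cycles g = cong sign (cycles-parity n g)

    sign-cycles-∘-odd : ∀ {g h} → OddParity h → sign (parity (cycles (g ∘ₚ h))) ≡ - sign (parity (cycles g))
    sign-cycles-∘-odd {g} {h} h-odd = begin
      sign (parity (cycles (g ∘ₚ h)))                                 ≡⟨ sign-cycles (g ∘ₚ h) ⟩
      sign (parity n ℙ.+ parity (inversions (g ∘ₚ h)))                ≡⟨ cong (λ p → sign (parity n ℙ.+ p)) (parity-inversions-∘ g h) ⟩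
      sign (parity n ℙ.+ (parity (inversions g) ℙ.+ parity (inversions h))) ≡⟨ cong (λ p → sign (parity n ℙ.+ (parity (inversions g) ℙ.+ p))) h-odd ⟩
      sign (parity n ℙ.+ (parity (inversions g) ℙ.+ 1ℙ))              ≡⟨ cong sign (ℙP.+-assoc (parity n) (parity (inversions g)) 1ℙ) ⟨
      sign (parity n ℙ.+ parity (inversions g) ℙ.+ 1ℙ)                ≡⟨ cong sign (ℙP.+-comm (parity n ℙ.+ parity (inversions g)) 1ℙ) ⟩
      sign ((parity n ℙ.+ parity (inversions g)) ℙ.⁻¹)                ≡⟨ sign-⁻¹ (parity n ℙ.+ parity (inversions g)) ⟩
      - sign (parity n ℙ.+ parity (inversions g))                     ≡⟨ cong -_ (sign-cycles g) ⟨
      - sign (parity (cycles g))                                      ∎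
      where open ≡-Reasoning

    sign-cycles-even : ∀ {g} → ¬ OddParity g → sign (parity (cycles g)) ≡ sign (parity n)
    sign-cycles-even {g} g-even with parity (inversions g) | sign-cycles g
    ... | 0ℙ | e = trans e (cong sign (ℙP.+-identityʳ (parity n)))
    ... | 1ℙ | _ = contradiction refl g-even

    signedFixers-odd : ∀ {k} (f : Fin n → Fin k) {h} → h ∈ₚ G → Fixes h f → OddParity h → signedFixers f ≡ + 0
    signedFixers-odd f {h} h∈G h-fixes h-odd = self-negating (begin
      signedFixers f                 ≡⟨ ∑ₗ-translate G-group ψ-resp {h} h∈G ⟨
      ∑ₗ G (λ g → ψ (g ∘ₚ h))        ≡⟨ ∑ₗ-cong G flip-sign ⟩
      ∑ₗ G (λ g → - ψ g)             ≡⟨ ∑ₗ-neg G ψ ⟩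
      - signedFixers f               ∎)
      where
      open ≡-Reasoning
      ψ = λ g → + χ (fixes? g f) *ℤ sign (parity (cycles g))
      ψ-resp : ψ Preserves _≈ₚ_ ⟶ _≡_
      ψ-resp {a} {b} a≈b = cong₂ (λ x c → + x *ℤ sign (parity c))
        (χ-cong (Fixes-≈ₚ {g = a} {b} f a≈b) (Fixes-≈ₚ {g = b} {a} f (λ i → sym (a≈b i))) (fixes? a f) (fixes? b f))
        (cycles-cong {g = a} {b} a≈b)
      flip-sign : ∀ g → ψ (g ∘ₚ h) ≡ - ψ g
      flip-sign g = trans
        (cong₂ (λ x s → + x *ℤ s)
          (χ-cong (λ fixes x → trans (sym (h-fixes (g ⟨$⟩ʳ x))) (fixes x)) (λ fixes x → trans (h-fixes (g ⟨$⟩ʳ x)) (fixes x))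
                  (fixes? (g ∘ₚ h) f) (fixes? g f))
          (sign-cycles-∘-odd {g} {h} h-odd))
        (sym (ZP.neg-distribʳ-* (+ χ (fixes? g f)) _))
      self-negating : ∀ {x} → x ≡ - x → x ≡ + 0
      self-negating {+ zero}    _ = refl
      self-negating {+ suc _}   ()
      self-negating { -[1+ _ ]} ()

    signedFixers-even : ∀ {k} (f : Fin n → Fin k) → ¬ HasOddFixer f → signedFixers f ≡ sign (parity n) *ℤ + #fixers f
    signedFixers-even f no-odd = begin
      signedFixers f                                      ≡⟨ ∑ₗ-congᴬ (All.map (λ {g} → even-summand g (fixes? g f)) (AllP.¬Any⇒All¬ G no-odd)) ⟩
      ∑ₗ G (λ g → + χ (fixes? g f) *ℤ sign (parity n))    ≡⟨ ∑ₗ-*ʳ G (λ g → + χ (fixes? g f)) (sign (parity n)) ⟩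
      ∑ₗ G (λ g → + χ (fixes? g f)) *ℤ sign (parity n)    ≡⟨ cong (_*ℤ sign (parity n)) (∑ₗ-pos G (λ g → χ (fixes? g f))) ⟩
      + #fixers f *ℤ sign (parity n)                      ≡⟨ ZP.*-comm (+ #fixers f) (sign (parity n)) ⟩
      sign (parity n) *ℤ + #fixers f                      ∎
      where
      open ≡-Reasoning
      even-summand : ∀ g (d : Dec (Fixes g f)) → ¬ (Fixes g f × OddParity g) →
        + χ d *ℤ sign (parity (cycles g)) ≡ + χ d *ℤ sign (parity n)
      even-summand g (yes fixes) not-odd = cong (+ 1 *ℤ_) (sign-cycles-even (λ odd → not-odd (fixes , odd)))
      even-summand g (no _)      _       = refl

  signedFixers-weight : ∀ {k} (f : Fin n → Fin k) → signedFixers f ≡ sign (parity n) *ℤ + weight f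
  signedFixers-weight f with hasOddFixer? f
  ... | yes odd = let g , g∈G , g-fixes , g-odd = Any⇒∈ₚ odd in
                  trans (signedFixers-odd f {g} g∈G g-fixes g-odd) (sym (ZP.*-zeroʳ (sign (parity n))))
  ... | no no-odd = signedFixers-even f no-odd

  #fixers-pos : ∀ {k} (f : Fin n → Fin k) → #fixers f ≢ 0
  #fixers-pos f = go G (Any.map (λ {h} id≈h → Fixes-≈ₚ {g = id} {h} f id≈h (λ _ → refl)) hasId)
    where
    go : ∀ xs → Any (λ g → Fixes g f) xs → sumₗ (map (λ g → χ (fixes? g f)) xs) ≢ 0
    go (g ∷ gs) (here fixes) e = ℕP.1+n≢0 (trans (cong (_+ sumₗ (map (λ g → χ (fixes? g f)) gs)) (sym (χ-yes fixes (fixes? g f)))) e)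
    go (g ∷ gs) (there any)  e = go gs any (ℕP.m+n≡0⇒n≡0 (χ (fixes? g f)) e)

  weight≡0⇔ : ∀ {k} (f : Fin n → Fin k) → weight f ≡ 0 ⇔ HasOddFixer f
  weight≡0⇔ f with hasOddFixer? f
  ... | yes odd   = mk⇔ (λ _ → odd) (λ _ → refl)
  ... | no no-odd = mk⇔ (λ e → contradiction e (#fixers-pos f)) (λ odd → contradiction odd no-odd)

  weight-cong : ∀ {k} {f f′ : Fin n → Fin k} → f ≗ f′ → weight f ≡ weight f′
  weight-cong {f = f} {f′} f≗f′ with hasOddFixer? f | hasOddFixer? f′
  ... | yes _   | yes _    = refl
  ... | yes odd | no no-odd = contradiction (Any.map (λ {g} (fixes , g-odd) → Fixes-≗ g f≗f′ fixes , g-odd) odd) no-odd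
  ... | no no-odd | yes odd = contradiction (Any.map (λ {g} (fixes , g-odd) → Fixes-≗ g (sym ∘ f≗f′) fixes , g-odd) odd) no-odd
  ... | no _    | no _     = cong sumₗ (ListP.map-cong (λ g → χ-cong (Fixes-≗ g f≗f′) (Fixes-≗ g (sym ∘ f≗f′)) (fixes? g f) (fixes? g f′)) G)

  F-neg : ∀ k → F G (- (+ k)) ≡ sign (parity n) *ℤ + ℕᶜ.∑ᶜ n k weight
  F-neg k = begin
    ∑ₗ G (λ g → (- + k) ^ℤ cycles g)
      ≡⟨ ∑ₗ-cong G (λ g → neg-^ k (cycles g)) ⟩
    ∑ₗ G (λ g → s g *ℤ + (k ^ cycles g))
      ≡⟨ ∑ₗ-cong G (λ g → cong (λ m → s g *ℤ + m) (#fixedColourings≡^cycles n g k)) ⟨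
    ∑ₗ G (λ g → s g *ℤ + #fixedColourings g k)
      ≡⟨ ∑ₗ-cong G (λ g → cong (s g *ℤ_) (∑ᶜ-pos n k (λ f → χ (fixes? g f)))) ⟨
    ∑ₗ G (λ g → s g *ℤ ℤᶜ.∑ᶜ n k (λ f → + χ (fixes? g f)))
      ≡⟨ ∑ₗ-cong G (λ g → ℤᶜ.*-distribˡ-∑ᶜ n k (s g) (λ f → + χ (fixes? g f))) ⟩
    ∑ₗ G (λ g → ℤᶜ.∑ᶜ n k (λ f → s g *ℤ + χ (fixes? g f)))
      ≡⟨ ∑ᶜ-∑ₗ n k G (λ g f → s g *ℤ + χ (fixes? g f)) ⟨
    ℤᶜ.∑ᶜ n k (λ f → ∑ₗ G (λ g → s g *ℤ + χ (fixes? g f)))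
      ≡⟨ ℤᶜ.∑ᶜ-cong n k (λ f → trans (∑ₗ-cong G (λ g → ZP.*-comm (s g) _)) (signedFixers-weight f)) ⟩
    ℤᶜ.∑ᶜ n k (λ f → sign (parity n) *ℤ + weight f)
      ≡⟨ ℤᶜ.*-distribˡ-∑ᶜ n k (sign (parity n)) (λ f → + weight f) ⟨
    sign (parity n) *ℤ ℤᶜ.∑ᶜ n k (λ f → + weight f)
      ≡⟨ cong (sign (parity n) *ℤ_) (∑ᶜ-pos n k weight) ⟩
    sign (parity n) *ℤ + ℕᶜ.∑ᶜ n k weight
      ∎
    where
    open ≡-Reasoning
    s = λ g → sign (parity (cycles g))

  AllColouringsOddFixed : ℕ → Set
  AllColouringsOddFixed k = ∀ (f : Fin n → Fin k) → HasOddFixer f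

  F-neg≡0⇔ : ∀ k → F G (- (+ k)) ≡ + 0 ⇔ AllColouringsOddFixed k
  F-neg≡0⇔ k = mk⇔
    (λ e f → Equivalence.to (weight≡0⇔ f)
      (∑ᶜ≡0⇒ n k weight weight-cong (ZP.+-injective (sign*x≡0⇒x≡0 (parity n) (trans (sym (F-neg k)) e))) f))
    (λ all → trans (F-neg k) (trans (cong (λ m → sign (parity n) *ℤ + m)
      (trans (ℕᶜ.∑ᶜ-cong n k (λ f → Equivalence.from (weight≡0⇔ f) (all f))) (ℕᶜ.∑ᶜ-zero n k))) (ZP.*-zeroʳ (sign (parity n)))))

  allOddFixed-1 : ∀ {g} → g ∈ₚ G → IsOdd g → AllColouringsOddFixed 1
  allOddFixed-1 {g} g∈G g-odd f = Any.map (λ {h} g≈h →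
      (λ x → single (f (h ⟨$⟩ʳ x)) (f x)) ,
      trans (cong parity (inversions-cong {g = h} {g} (λ i → sym (g≈h i)))) (%2≡1⇒parity≡1ℙ (inversions g) g-odd))
    g∈G
    where
    single : ∀ (a b : Fin 1) → a ≡ b
    single zero zero = refl

  allOddFixed-pred : ∀ {k} → AllColouringsOddFixed (suc k) → AllColouringsOddFixed k
  allOddFixed-pred all f = Any.map (λ (fixes , odd) → FinP.inject₁-injective ∘ fixes , odd) (all (inject₁ ∘ f))

  -- An element fixing the colouring by distinct colours is the identity, which is even.
  ¬allOddFixed-n : ¬ AllColouringsOddFixed n
  ¬allOddFixed-n all with Any⇒∈ₚ (all (λ x → x))
  ... | g , _ , fixes , g-odd = contradiction
    (trans (sym g-odd) (cong parity (trans (inversions-cong {g = g} {id} fixes) (inversions-id n)))) (λ ())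

module _ {P : ℕ → Set} (P? : ∀ k → Dec (P k)) (P-pred : ∀ k → P (suc k) → P k) where

  private
    P-≤′ : ∀ {j k} → j ≤′ k → P k → P j
    P-≤′ ≤′-refl        p = p
    P-≤′ (≤′-step j≤′k) p = P-≤′ j≤′k (P-pred _ p)

    lastSatisfied : P 1 → ∀ m → ¬ P (suc m) → ∃ λ a → 1 ≤ a × P a × ¬ P (suc a)
    lastSatisfied p₁ zero    ¬p = contradiction p₁ ¬p
    lastSatisfied p₁ (suc m) ¬p with P? (suc m)
    ... | yes p  = suc m , s≤s z≤n , p , ¬p
    ... | no ¬p′ = lastSatisfied p₁ m ¬p′

  downClosed⇒initialSegment : P 1 → ∀ m → ¬ P m → ∃ λ a → 1 ≤ a × (∀ k → P k ⇔ k ≤ a)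
  downClosed⇒initialSegment p₁ m ¬pₘ with lastSatisfied p₁ m (¬pₘ ∘ P-pred m)
  ... | a , 1≤a , pₐ , ¬pₐ₊₁ = a , 1≤a , λ k → mk⇔
    (λ pₖ → ℕP.≮⇒≥ (λ a<k → ¬pₐ₊₁ (P-≤′ (ℕP.≤⇒≤′ a<k) pₖ)))
    (λ k≤a → P-≤′ (ℕP.≤⇒≤′ k≤a) pₐ)

mainTheorem7 : (n : ℕ) (G : List (Permutation′ n)) → IsPermGroup G →
    ∃ (λ g → (g ∈ₚ G) × IsOdd g) →
    ∃ λ (a : ℕ) → (1 ≤ a) ×
      ((k : ℕ) → 1 ≤ k → ((F G (- (+ k)) ≡ + 0) ⇔ (k ≤ a)))
mainTheorem7 n G G-group (g , g∈G , g-odd) =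
  let a , 1≤a , segment = downClosed⇒initialSegment (λ k → F G (- (+ k)) ZP.≟ + 0) Z-pred
                            (from (F-neg≡0⇔ 1) (allOddFixed-1 {g} g∈G g-odd)) n (¬allOddFixed-n ∘ to (F-neg≡0⇔ n))
  in a , 1≤a , λ k _ → segment k
  where
  open SignedCount G-group
  open Equivalence
  Z-pred : ∀ k → F G (- (+ suc k)) ≡ + 0 → F G (- (+ k)) ≡ + 0
  Z-pred k = from (F-neg≡0⇔ k) ∘ allOddFixed-pred ∘ to (F-neg≡0⇔ (suc k))
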